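{- Let $\ell_1=\ell_2=\ell\ge1$, let $\mathscr{M}=\{(a,b)\in\mathbb{Z}^2: 0\le a,b\le \ell-1\}$ with the componentwise order, and let $\mathrm{wt}$ be a rank increasing and rank constant weight function on $\mathscr{M}$. Then for every $m\in\{0,1,\dots,\ell^2\}$, the initial segment of size $m$ of $\mathcal{C}$ and the initial segment of size $m$ of $\mathcal{L}$ have the same weight. Moreover, every lexicographic type set and every colexicographic type set is an optimal downset.
   Context: The rank of $(a,b)$ is $a+b$; $\mathrm{wt}$ is rank constant if equal ranks give equal weights and rank increasing if strictly smaller rank gives strictly smaller weight; $\mathrm{wt}(S)=\sum_{s\in S}\mathrm{wt}(s)$. A downset is a subset closed downward in the componentwise order; it is optimal if its weight is at least that of any downset of the same size. $\mathcal{L}$: $(a,b)<(c,d)$ iff $a<c$, or $a=c$ and $b<d$. $\mathcal{C}$: $(a,b)<(c,d)$ iff $b<d$, or $b=d$ and $a<c$. The initial segment of size $m$ of a total order is the set of its $m$ smallest elements. A packed poset is $\mathscr{Q}=\{(a,b): s_1\le a\le t_1,\ s_2\le b\le t_2\}\subseteq\mathscr{M}$. For $c_1=c_2$, $\mathrm{Sym}(\mathscr{Q},A,c_1,c_2)=A$; for $\{c_1,c_2\}=\{1,2\}$ with $t_1-s_1=t_2-s_2$, let $\rho(a,b)=(s_1+b-s_2,s_2+a-s_1)$ on $\mathscr{Q}$, local coordinates $u_1=a-s_1,u_2=b-s_2$, $f_{(c_1,c_2)}=\rho(f)$ if $u_{c_1}<u_{c_2}$ and $=f$ otherwise, and $\mathrm{Sym}(\mathscr{Q},A,c_1,c_2)=(A\setminus\mathscr{Q})\cup\{f\in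 A\cap\mathscr{Q}:\rho(f)\in A\}\cup\{f_{(c_1,c_2)}:f\in A\cap\mathscr{Q}\}$. A lexicographic (resp. colexicographic) type set of size $m$ is a set $\mathrm{Sym}(\mathscr{Q},I,c_1,c_2)$ for some packed poset $\mathscr{Q}$ and $c_1,c_2\in\{1,2\}$, where $I$ is the initial segment of size $m$ of $\mathcal{L}$ (resp. $\mathcal{C}$), and which is a downset.
   Formalization: The weight function $\mathrm{wt}$ on $\mathscr{M}$ takes only rational values instead of real values. -}

module Defs where

open import Data.Nat using (ℕ; zero; suc; _+_; _*_; _∸_; _≤_; _<_; _<ᵇ_; _≡ᵇ_; _≤ᵇ_)
open import Data.Bool using (Bool; true; false; _∧_; _∨_; not; if_then_else_)
open import Data.Product using (_×_; _,_; proj₁; proj₂; Σ)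
open import Data.Sum using (_⊎_)
open import Data.List using (List; []; _∷_; map; concatMap; filterᵇ; length; upTo; foldr)
open import Data.Bool.ListAction using (any)
open import Data.Fin using (Fin; zero; suc)
import Data.Fin as Fin
open import Relation.Nullary using (does; ¬_)
open import Relation.Binary.PropositionalEquality using (_≡_)
open import Data.Rational using (ℚ; 0ℚ) renaming (_+_ to _+ℚ_; _<_ to _<ℚ_; _≤_ to _≤ℚ_)

Pt : Set
Pt = ℕ × ℕ

-- A subset of M, given by its (decidable) characteristic function.
-- Only its values on points of M matter.
SubM : Set
SubM = Pt → Bool

cells : ℕ → List Pt
cells ℓ = concatMap (λ a → map (λ b → (a , b)) (upTo ℓ)) (upTo ℓ)

inM : ℕ → Pt → Bool
inM ℓ (a , b) = (a <ᵇ ℓ) ∧ (b <ᵇ ℓ)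

size : ℕ → SubM → ℕ
size ℓ S = length (filterᵇ S (cells ℓ))

sumℚ : List ℚ → ℚ
sumℚ = foldr _+ℚ_ 0ℚ

wtSet : ℕ → (Pt → ℚ) → SubM → ℚ
wtSet ℓ wt S = sumℚ (map wt (filterᵇ S (cells ℓ)))

rank : Pt → ℕ
rank (a , b) = a + b

RankConstant : ℕ → (Pt → ℚ) → Set
RankConstant ℓ wt = ∀ a b c d → a < ℓ → b < ℓ → c < ℓ → d < ℓ →
  rank (a , b) ≡ rank (c , d) → wt (a , b) ≡ wt (c , d)

RankIncreasing : ℕ → (Pt → ℚ) → Set
RankIncreasing ℓ wt = ∀ a b c d → a < ℓ → b < ℓ → c < ℓ → d < ℓ →
  rank (a , b) < rank (c , d) → wt (a , b) <ℚ wt (c , d)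

IsDownset : ℕ → SubM → Set
IsDownset ℓ S = ∀ a b c d → c < ℓ → d < ℓ → a ≤ c → b ≤ d →
  S (c , d) ≡ true → S (a , b) ≡ true

IsOptimalDownset : ℕ → (Pt → ℚ) → SubM → Set
IsOptimalDownset ℓ wt S = IsDownset ℓ S ×
  (∀ (D : SubM) → IsDownset ℓ D → size ℓ D ≡ size ℓ S → wtSet ℓ wt D ≤ℚ wtSet ℓ wt S)

ltL : Pt → Pt → Bool
ltL (a , b) (c , d) = (a <ᵇ c) ∨ ((a ≡ᵇ c) ∧ (b <ᵇ d))

ltC : Pt → Pt → Bool
ltC (a , b) (c , d) = (b <ᵇ d) ∨ ((b ≡ᵇ d) ∧ (a <ᵇ c))

-- initial segment of size m of a total order `lt` on M: the elements x of M
-- having fewer than m elements of M strictly below them, i.e. the m smallest elements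
initSeg : ℕ → (Pt → Pt → Bool) → ℕ → SubM
initSeg ℓ lt m x = inM ℓ x ∧ (length (filterᵇ (λ y → lt y x) (cells ℓ)) <ᵇ m)

initL initC : ℕ → ℕ → SubM
initL ℓ = initSeg ℓ ltL
initC ℓ = initSeg ℓ ltC

-- packed poset Q = [s1,t1] × [s2,t2]
record Packed : Set where
  constructor packed
  field
    s₁ t₁ s₂ t₂ : ℕ
open Packed public

PackedIn : ℕ → Packed → Set
PackedIn ℓ Q = (s₁ Q ≤ t₁ Q) × (t₁ Q < ℓ) × (s₂ Q ≤ t₂ Q) × (t₂ Q < ℓ)

inQ : Packed → Pt → Bool
inQ Q (a , b) = (s₁ Q ≤ᵇ a) ∧ (a ≤ᵇ t₁ Q) ∧ (s₂ Q ≤ᵇ b) ∧ (b ≤ᵇ t₂ Q)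

ρ : Packed → Pt → Pt
ρ Q (a , b) = (s₁ Q + (b ∸ s₂ Q) , s₂ Q + (a ∸ s₁ Q))

u : Packed → Pt → Fin 2 → ℕ
u Q (a , b) zero = a ∸ s₁ Q
u Q (a , b) (suc _) = b ∸ s₂ Q

fc : Packed → Fin 2 → Fin 2 → Pt → Pt
fc Q c₁ c₂ f = if u Q f c₁ <ᵇ u Q f c₂ then ρ Q f else f

eqPt : Pt → Pt → Bool
eqPt (a , b) (c , d) = (a ≡ᵇ c) ∧ (b ≡ᵇ d)

-- Sym(Q, A, c1, c2); the case c1 ≠ c2 is meaningful only when t1-s1 = t2-s2
-- (this side condition is imposed where Sym is used).
Sym : ℕ → Packed → SubM → Fin 2 → Fin 2 → SubM
Sym ℓ Q A c₁ c₂ x =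
  if does (c₁ Fin.≟ c₂) then A x
  else ((A x ∧ not (inQ Q x))
        ∨ (A x ∧ inQ Q x ∧ A (ρ Q x))
        ∨ any (λ f → A f ∧ inQ Q f ∧ eqPt (fc Q c₁ c₂ f) x) (cells ℓ))

SymDefined : Packed → Fin 2 → Fin 2 → Set
SymDefined Q c₁ c₂ = (c₁ ≡ c₂) ⊎ (¬ (c₁ ≡ c₂) × (t₁ Q ∸ s₁ Q ≡ t₂ Q ∸ s₂ Q))

-- X is a set of type `init` (lexicographic: initL, colexicographic: initC) of size m
-- (X agrees with some defined Sym(Q, I, c1, c2) on M, and X is a downset)
TypeSet : ℕ → (ℕ → ℕ → SubM) → ℕ → SubM → Set
TypeSet ℓ init m X =
  Σ Packed λ Q → Σ (Fin 2) λ c₁ → Σ (Fin 2) λ c₂ →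
    PackedIn ℓ Q × SymDefined Q c₁ c₂ ×
    (∀ x → inM ℓ x ≡ true → X x ≡ Sym ℓ Q (init ℓ m) c₁ c₂ x) ×
    IsDownset ℓ X

-- Since wt is rank constant and rank increasing, wt (a , b) = w (a + b) on M for a
-- non-decreasing w : ℕ → ℚ. The initial segment of 𝓛 of size m is the row-major prefix of size m
-- of the grid and that of 𝓒 is its transpose; as a + b is symmetric they have the same weight.
-- A downset of size m in a W × H grid with W ≤ H weighs at most the row-major prefix of size m,
-- by induction on m: either its first row is full and is peeled off, or its last row is empty,
-- or its first column is full and is peeled off (after transposing if the grid is square); the
-- column together with the shifted prefix is then dominated by the prefix of the same size,
-- because w is non-decreasing. Finally Sym(Q, I, c₁, c₂) only rearranges I inside Q: on each
-- pair {f , ρ f} it puts I f ∧ I (ρ f) at the point that moves and I f ∨ I (ρ f) at the other,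
-- and [p ∧ q] + [p ∨ q] = [p] + [q]. As ρ preserves rank, Sym preserves size and weight, so a
-- type set that is a downset has the weight of the optimal prefix.

module Submission where

open import Algebra.Bundles using (CommutativeMonoid; CommutativeSemigroup)
open import Algebra.Core using (Op₂)
open import Algebra.Structures using (IsCommutativeMonoid)
open import Data.Bool using (Bool; true; false; _∧_; _∨_; not; T; if_then_else_)
import Data.Bool.Properties as Boolₚ
open import Data.Bool.ListAction using (any)
open import Data.Fin using (Fin)
import Data.Fin as Fin
open import Data.List using (List; []; _∷_; map; foldr; _++_; concatMap; applyUpTo; upTo; filterᵇ; length)
open import Data.List.Properties using (map-∘)
open import Data.List.Membership.Propositional using (_∈_)
open import Data.List.Membership.Propositional.Properties using (∈-concatMap⁺; ∈-map⁺; ∈-upTo⁺)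
open import Data.List.Relation.Unary.Any using (here; there)
import Data.List.Relation.Unary.Any as Any
open import Data.Nat using (ℕ; zero; suc; _+_; _*_; _∸_; _⊓_; _<_; _≤_; s≤s; z≤n; _<ᵇ_; _≡ᵇ_; _≤ᵇ_; _≤?_)
open import Data.Nat.Induction using (<-rec)
import Data.Nat.Properties as ℕₚ
open import Data.Nat.Tactic.RingSolver using (solve-∀)
open import Data.Product using (Σ; _×_; _,_; proj₁; proj₂)
open import Data.Rational using (ℚ) renaming (_+_ to _+ℚ_; _≤_ to _≤ℚ_)
import Data.Rational.Properties as ℚₚ
open import Data.Sum using (_⊎_; inj₁; inj₂)
open import Data.Unit using (tt)
open import Function using (_∘_)
open import Relation.Binary.PropositionalEquality
open import Relation.Nullary using (yes; no; contradiction)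

open import Algebra.Properties.CommutativeSemigroup (CommutativeMonoid.commutativeSemigroup ℚₚ.+-0-commutativeMonoid)
  using () renaming (interchange to +-interchange)

open import Defs

<ᵇ-true : ∀ {m n} → m < n → (m <ᵇ n) ≡ true
<ᵇ-true {zero}  {suc n} _       = refl
<ᵇ-true {suc m} {suc n} (s≤s p) = <ᵇ-true p

<ᵇ-false : ∀ {m n} → n ≤ m → (m <ᵇ n) ≡ false
<ᵇ-false {m}     {zero}  _       = refl
<ᵇ-false {suc m} {suc n} (s≤s p) = <ᵇ-false p

≤ᵇ-true : ∀ {m n} → m ≤ n → (m ≤ᵇ n) ≡ true
≤ᵇ-true {zero}  _   = refl
≤ᵇ-true {suc m} m≤n = <ᵇ-true m≤n

≤ᵇ-false : ∀ {m n} → n < m → (m ≤ᵇ n) ≡ false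
≤ᵇ-false {suc m} (s≤s n≤m) = <ᵇ-false n≤m

≤ᵇ-sound : ∀ {m n} → (m ≤ᵇ n) ≡ true → m ≤ n
≤ᵇ-sound {m} {n} m≤ᵇn = ℕₚ.≤ᵇ⇒≤ m n (subst T (sym m≤ᵇn) tt)

≡ᵇ-refl : ∀ n → (n ≡ᵇ n) ≡ true
≡ᵇ-refl zero    = refl
≡ᵇ-refl (suc n) = ≡ᵇ-refl n

inM-true : ∀ {ℓ a b} → a < ℓ → b < ℓ → inM ℓ (a , b) ≡ true
inM-true a<ℓ b<ℓ = cong₂ _∧_ (<ᵇ-true a<ℓ) (<ᵇ-true b<ℓ)

+-<ᵇ-+ : ∀ k m n → (k + m <ᵇ k + n) ≡ (m <ᵇ n)
+-<ᵇ-+ zero    m n = refl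
+-<ᵇ-+ (suc k) m n = +-<ᵇ-+ k m n

∨-true : ∀ {p q} → p ∨ q ≡ true → p ≡ true ⊎ q ≡ true
∨-true {true}  _ = inj₁ refl
∨-true {false} q = inj₂ q

∨-trueʳ : ∀ p {q} → q ≡ true → p ∨ q ≡ true
∨-trueʳ p refl = Boolₚ.∨-zeroʳ p

≡true-ext : ∀ {p q} → (p ≡ true → q ≡ true) → (q ≡ true → p ≡ true) → p ≡ q
≡true-ext {false} {false} _ _ = refl
≡true-ext {false} {true}  _ q⇒p = q⇒p refl
≡true-ext {true}  {false} p⇒q _ = sym (p⇒q refl)
≡true-ext {true}  {true}  _ _ = refl

any-true⇒ : ∀ {B : Set} (p : B → Bool) xs → any p xs ≡ true → Σ B λ x → p x ≡ true
any-true⇒ p (x ∷ xs) any≡true with p x in px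
... | true  = x , px
... | false = any-true⇒ p xs any≡true

∈⇒any-true : ∀ {B : Set} (p : B → Bool) {x xs} → x ∈ xs → p x ≡ true → any p xs ≡ true
∈⇒any-true p {xs = _ ∷ xs} (here refl) px = cong (_∨ any p xs) px
∈⇒any-true p (there x∈xs) px = ∨-trueʳ _ (∈⇒any-true p x∈xs px)

∈-cells : ∀ {ℓ a b} → a < ℓ → b < ℓ → (a , b) ∈ cells ℓ
∈-cells {ℓ} a<ℓ b<ℓ =
  ∈-concatMap⁺ (λ a → map (a ,_) (upTo ℓ)) (Any.map (λ { refl → ∈-map⁺ (_ ,_) (∈-upTo⁺ b<ℓ) }) (∈-upTo⁺ a<ℓ))

eqPt⇒≡ : ∀ x y → eqPt x y ≡ true → x ≡ y
eqPt⇒≡ (a , b) (c , d) eq = cong₂ _,_ (≡ᵇ⇒≡ (Boolₚ.∧-conicalˡ _ _ eq)) (≡ᵇ⇒≡ (Boolₚ.∧-conicalʳ _ _ eq))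
  where
  ≡ᵇ⇒≡ : ∀ {m n} → (m ≡ᵇ n) ≡ true → m ≡ n
  ≡ᵇ⇒≡ {m} {n} m≡ᵇn = ℕₚ.≡ᵇ⇒≡ m n (subst T (sym m≡ᵇn) tt)

eqPt-refl : ∀ x → eqPt x x ≡ true
eqPt-refl (a , b) = cong₂ _∧_ (≡ᵇ-refl a) (≡ᵇ-refl b)

Grid : Set
Grid = ℕ → ℕ → Bool

lexPrefix : ℕ → ℕ → Grid
lexPrefix H m a b = a * H + b <ᵇ m

lexPrefix-nextRow : ∀ H m a b → lexPrefix H (H + m) (suc a) b ≡ lexPrefix H m a b
lexPrefix-nextRow H m a b = trans (cong (_<ᵇ H + m) (ℕₚ.+-assoc H (a * H) b)) (+-<ᵇ-+ H (a * H + b) m)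

-- Finite sums in a commutative monoid

module FiniteSum {R : Set} {_∙_ : Op₂ R} {ε : R} (isCM : IsCommutativeMonoid _≡_ _∙_ ε) where

  open IsCommutativeMonoid isCM using (assoc; identityˡ; identityʳ; comm)
  open ≡-Reasoning

  commutativeSemigroup : CommutativeSemigroup _ _
  commutativeSemigroup = record { isCommutativeSemigroup = IsCommutativeMonoid.isCommutativeSemigroup isCM }

  open import Algebra.Properties.CommutativeSemigroup commutativeSemigroup using (interchange)

  ∑ : ℕ → (ℕ → R) → R
  ∑ zero    f = ε
  ∑ (suc n) f = f 0 ∙ ∑ n (f ∘ suc)

  ∑-cong : ∀ n {f g : ℕ → R} → (∀ i → i < n → f i ≡ g i) → ∑ n f ≡ ∑ n g
  ∑-cong zero    f≗g = refl
  ∑-cong (suc n) f≗g = cong₂ _∙_ (f≗g 0 (s≤s z≤n)) (∑-cong n (λ i i<n → f≗g (suc i) (s≤s i<n)))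

  ∑-ε : ∀ n {f : ℕ → R} → (∀ i → i < n → f i ≡ ε) → ∑ n f ≡ ε
  ∑-ε zero    f≗ε = refl
  ∑-ε (suc n) f≗ε = begin
    _ ∙ _ ≡⟨ cong₂ _∙_ (f≗ε 0 (s≤s z≤n)) (∑-ε n (λ i i<n → f≗ε (suc i) (s≤s i<n))) ⟩
    ε ∙ ε ≡⟨ identityˡ ε ⟩
    ε     ∎

  ∑-+ : ∀ m n (f : ℕ → R) → ∑ (m + n) f ≡ ∑ m f ∙ ∑ n (λ i → f (m + i))
  ∑-+ zero    n f = sym (identityˡ _)
  ∑-+ (suc m) n f = trans (cong (f 0 ∙_) (∑-+ m n (f ∘ suc))) (sym (assoc _ _ _))

  ∑-last : ∀ n (f : ℕ → R) → ∑ (suc n) f ≡ ∑ n f ∙ f n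
  ∑-last n f = begin
    ∑ (suc n) f                       ≡⟨ cong (λ k → ∑ k f) (ℕₚ.+-comm 1 n) ⟩
    ∑ (n + 1) f                       ≡⟨ ∑-+ n 1 f ⟩
    ∑ n f ∙ (f (n + 0) ∙ ε)           ≡⟨ cong (λ z → ∑ n f ∙ z) (identityʳ _) ⟩
    ∑ n f ∙ f (n + 0)                 ≡⟨ cong (λ k → ∑ n f ∙ f k) (ℕₚ.+-identityʳ n) ⟩
    ∑ n f ∙ f n                       ∎

  ∑-∙ : ∀ n (f g : ℕ → R) → ∑ n (λ i → f i ∙ g i) ≡ ∑ n f ∙ ∑ n g
  ∑-∙ zero    f g = sym (identityˡ ε)
  ∑-∙ (suc n) f g = trans (cong ((f 0 ∙ g 0) ∙_) (∑-∙ n (f ∘ suc) (g ∘ suc))) (interchange _ _ _ _)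

  ∑-comm : ∀ m n (F : ℕ → ℕ → R) → ∑ m (λ a → ∑ n (F a)) ≡ ∑ n (λ b → ∑ m (λ a → F a b))
  ∑-comm zero    n F = sym (∑-ε n (λ _ _ → refl))
  ∑-comm (suc m) n F = begin
    ∑ n (F 0) ∙ ∑ m (λ a → ∑ n (F (suc a)))       ≡⟨ cong (∑ n (F 0) ∙_) (∑-comm m n (F ∘ suc)) ⟩
    ∑ n (F 0) ∙ ∑ n (λ b → ∑ m (λ a → F (suc a) b)) ≡⟨ sym (∑-∙ n (F 0) _) ⟩
    ∑ n (λ b → ∑ (suc m) (λ a → F a b))           ∎

  fold : List R → R
  fold = foldr _∙_ ε

  fold-map-++ : ∀ {B : Set} (h : B → R) xs ys →
                fold (map h (xs ++ ys)) ≡ fold (map h xs) ∙ fold (map h ys)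
  fold-map-++ h []       ys = sym (identityˡ _)
  fold-map-++ h (x ∷ xs) ys = trans (cong (h x ∙_) (fold-map-++ h xs ys)) (sym (assoc _ _ _))

  fold-map-concatMap : ∀ {B C : Set} (h : B → R) (f : C → List B) xs →
                       fold (map h (concatMap f xs)) ≡ fold (map (fold ∘ map h ∘ f) xs)
  fold-map-concatMap h f []       = refl
  fold-map-concatMap h f (x ∷ xs) =
    trans (fold-map-++ h (f x) (concatMap f xs)) (cong (fold (map h (f x)) ∙_) (fold-map-concatMap h f xs))

  fold-map-applyUpTo : ∀ {B : Set} (h : B → R) (k : ℕ → B) n → fold (map h (applyUpTo k n)) ≡ ∑ n (h ∘ k)
  fold-map-applyUpTo h k zero    = refl
  fold-map-applyUpTo h k (suc n) = cong (h (k 0) ∙_) (fold-map-applyUpTo h (k ∘ suc) n)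

  cellSum : ℕ → (Pt → R) → R
  cellSum ℓ F = ∑ ℓ (λ a → ∑ ℓ (λ b → F (a , b)))

  fold-map-cells : ∀ ℓ (h : Pt → R) → fold (map h (cells ℓ)) ≡ cellSum ℓ h
  fold-map-cells ℓ h = begin
    fold (map h (cells ℓ))
      ≡⟨ fold-map-concatMap h _ (upTo ℓ) ⟩
    fold (map (λ a → fold (map h (map (a ,_) (upTo ℓ)))) (upTo ℓ))
      ≡⟨ fold-map-applyUpTo _ (λ a → a) ℓ ⟩
    ∑ ℓ (λ a → fold (map h (map (a ,_) (upTo ℓ))))
      ≡⟨ ∑-cong ℓ (λ a _ → trans (cong fold (sym (map-∘ (upTo ℓ)))) (fold-map-applyUpTo _ (λ b → b) ℓ)) ⟩
    cellSum ℓ h ∎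

  ind : Bool → R → R
  ind true  v = v
  ind false _ = ε

  fold-map-filterᵇ : ∀ {B : Set} (S : B → Bool) (h : B → R) xs →
                     fold (map h (filterᵇ S xs)) ≡ fold (map (λ x → ind (S x) (h x)) xs)
  fold-map-filterᵇ S h []       = refl
  fold-map-filterᵇ S h (x ∷ xs) with S x
  ... | true  = cong (h x ∙_) (fold-map-filterᵇ S h xs)
  ... | false = trans (fold-map-filterᵇ S h xs) (sym (identityˡ _))

  ∑-ind-< : ∀ n m (f : ℕ → R) → m ≤ n → ∑ n (λ i → ind (i <ᵇ m) (f i)) ≡ ∑ m f
  ∑-ind-< n m f m≤n with k , refl ← ℕₚ.m≤n⇒∃[o]m+o≡n m≤n = begin
    ∑ (m + k) (λ i → ind (i <ᵇ m) (f i))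
      ≡⟨ ∑-+ m k _ ⟩
    ∑ m (λ i → ind (i <ᵇ m) (f i)) ∙ ∑ k (λ i → ind (m + i <ᵇ m) (f (m + i)))
      ≡⟨ cong₂ _∙_ (∑-cong m (λ i i<m → cong (λ b → ind b (f i)) (<ᵇ-true i<m)))
                   (∑-ε k (λ i _ → cong (λ b → ind b (f (m + i))) (<ᵇ-false (ℕₚ.m≤m+n m i)))) ⟩
    ∑ m f ∙ ε
      ≡⟨ identityʳ _ ⟩
    ∑ m f ∎

  ∑-ind-true : ∀ n (p : ℕ → Bool) (f : ℕ → R) → (∀ i → i < n → p i ≡ true) →
               ∑ n (λ i → ind (p i) (f i)) ≡ ∑ n f
  ∑-ind-true n p f p≡true = ∑-cong n (λ i i<n → cong (λ b → ind b (f i)) (p≡true i i<n))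

  ind-∧ : ∀ p q v → ind (p ∧ q) v ≡ ind p (ind q v)
  ind-∧ true  q v = refl
  ind-∧ false q v = refl

  ind-∑ : ∀ p n (f : ℕ → R) → ind p (∑ n f) ≡ ∑ n (λ i → ind p (f i))
  ind-∑ true  n f = refl
  ind-∑ false n f = sym (∑-ε n (λ _ _ → refl))

  ind-split : ∀ p v → v ≡ ind p v ∙ ind (not p) v
  ind-split true  v = sym (identityʳ v)
  ind-split false v = sym (identityˡ v)

  ind-∧-∙-ind-∨ : ∀ p q v → ind (p ∧ q) v ∙ ind (p ∨ q) v ≡ ind p v ∙ ind q v
  ind-∧-∙-ind-∨ true  q     v = comm _ _
  ind-∧-∙-ind-∨ false true  v = refl
  ind-∧-∙-ind-∨ false false v = refl

  ∑-interval : ∀ s d ℓ (f : ℕ → R) → s + d < ℓ →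
               ∑ ℓ (λ a → ind ((s ≤ᵇ a) ∧ (a ≤ᵇ s + d)) (f a)) ≡ ∑ (suc d) (λ i → f (s + i))
  ∑-interval s d ℓ f s+d<ℓ with r , refl ← ℕₚ.m≤n⇒∃[o]m+o≡n s+d<ℓ = begin
    ∑ (suc (s + d) + r) h
      ≡⟨ cong (λ n → ∑ n h) (trans (cong (_+ r) (sym (ℕₚ.+-suc s d))) (ℕₚ.+-assoc s (suc d) r)) ⟩
    ∑ (s + (suc d + r)) h
      ≡⟨ ∑-+ s (suc d + r) h ⟩
    ∑ s h ∙ ∑ (suc d + r) (λ i → h (s + i))
      ≡⟨ cong (∑ s h ∙_) (∑-+ (suc d) r (λ i → h (s + i))) ⟩
    ∑ s h ∙ (∑ (suc d) (λ i → h (s + i)) ∙ ∑ r (λ i → h (s + (suc d + i))))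
      ≡⟨ cong₂ _∙_ (∑-ε s before) (cong₂ _∙_ (∑-cong (suc d) inside) (∑-ε r after)) ⟩
    ε ∙ (∑ (suc d) (λ i → f (s + i)) ∙ ε)
      ≡⟨ trans (identityˡ _) (identityʳ _) ⟩
    ∑ (suc d) (λ i → f (s + i)) ∎
    where
    h = λ a → ind ((s ≤ᵇ a) ∧ (a ≤ᵇ s + d)) (f a)
    before : ∀ a → a < s → h a ≡ ε
    before a a<s = cong (λ p → ind (p ∧ (a ≤ᵇ s + d)) (f a)) (≤ᵇ-false a<s)
    inside : ∀ i → i < suc d → h (s + i) ≡ f (s + i)
    inside i (s≤s i≤d) = cong (λ p → ind p (f (s + i)))
      (cong₂ _∧_ (≤ᵇ-true (ℕₚ.m≤m+n s i)) (≤ᵇ-true (ℕₚ.+-monoʳ-≤ s i≤d)))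
    after : ∀ i → i < r → h (s + (suc d + i)) ≡ ε
    after i _ = cong (λ p → ind p (f (s + (suc d + i))))
      (trans (cong ((s ≤ᵇ s + (suc d + i)) ∧_) (≤ᵇ-false (ℕₚ.+-monoʳ-< s (s≤s (ℕₚ.m≤m+n d i)))))
             (Boolₚ.∧-zeroʳ _))

  squareSum : ℕ → (ℕ → ℕ → R) → R
  squareSum n G = ∑ n (λ i → ∑ n (G i))

  squareSum-suc : ∀ n G → squareSum (suc n) G ≡ squareSum n G ∙ (∑ n (λ i → G n i ∙ G i n) ∙ G n n)
  squareSum-suc n G = begin
    ∑ (suc n) (λ i → ∑ (suc n) (G i))
      ≡⟨ ∑-cong (suc n) (λ i _ → ∑-last n (G i)) ⟩
    ∑ (suc n) (λ i → ∑ n (G i) ∙ G i n)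
      ≡⟨ ∑-∙ (suc n) (λ i → ∑ n (G i)) (λ i → G i n) ⟩
    ∑ (suc n) (λ i → ∑ n (G i)) ∙ ∑ (suc n) (λ i → G i n)
      ≡⟨ cong₂ _∙_ (∑-last n _) (∑-last n _) ⟩
    (squareSum n G ∙ ∑ n (G n)) ∙ (∑ n (λ i → G i n) ∙ G n n)
      ≡⟨ assoc _ _ _ ⟩
    squareSum n G ∙ (∑ n (G n) ∙ (∑ n (λ i → G i n) ∙ G n n))
      ≡⟨ cong (squareSum n G ∙_) (trans (sym (assoc _ _ _)) (cong (_∙ G n n) (sym (∑-∙ n (G n) _)))) ⟩
    squareSum n G ∙ (∑ n (λ i → G n i ∙ G i n) ∙ G n n) ∎

  squareSum-pairwise : ∀ n (G H : ℕ → ℕ → R) → (∀ i → i < n → G i i ≡ H i i) →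
    (∀ i j → j < i → i < n → G i j ∙ G j i ≡ H i j ∙ H j i) → squareSum n G ≡ squareSum n H
  squareSum-pairwise zero    G H diag pair = refl
  squareSum-pairwise (suc n) G H diag pair = begin
    squareSum (suc n) G
      ≡⟨ squareSum-suc n G ⟩
    squareSum n G ∙ (∑ n (λ i → G n i ∙ G i n) ∙ G n n)
      ≡⟨ cong₂ _∙_ (squareSum-pairwise n G H (λ i i<n → diag i (ℕₚ.m≤n⇒m≤1+n i<n))
                                             (λ i j j<i i<n → pair i j j<i (ℕₚ.m≤n⇒m≤1+n i<n)))
                   (cong₂ _∙_ (∑-cong n (λ i i<n → pair n i i<n ℕₚ.≤-refl)) (diag n ℕₚ.≤-refl)) ⟩
    squareSum n H ∙ (∑ n (λ i → H n i ∙ H i n) ∙ H n n)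
      ≡⟨ sym (squareSum-suc n H) ⟩
    squareSum (suc n) H ∎

  gridSum : ℕ → ℕ → Grid → (ℕ → ℕ → R) → R
  gridSum W H D F = ∑ W (λ a → ∑ H (λ b → ind (D a b) (F a b)))

  gridSum-cong : ∀ W H {D D′ : Grid} (F : ℕ → ℕ → R) →
                 (∀ a b → a < W → b < H → D a b ≡ D′ a b) → gridSum W H D F ≡ gridSum W H D′ F
  gridSum-cong W H F D≗D′ =
    ∑-cong W (λ a a<W → ∑-cong H (λ b b<H → cong (λ z → ind z (F a b)) (D≗D′ a b a<W b<H)))

  gridSum-transpose : ∀ W H D F → gridSum W H D F ≡ gridSum H W (λ b a → D a b) (λ b a → F a b)
  gridSum-transpose W H D F = ∑-comm W H _

  gridSum-∅ : ∀ W H D F → (∀ a b → a < W → b < H → D a b ≡ false) → gridSum W H D F ≡ ε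
  gridSum-∅ W H D F D≡false =
    ∑-ε W (λ a a<W → ∑-ε H (λ b b<H → cong (λ z → ind z (F a b)) (D≡false a b a<W b<H)))

  gridSum-firstColumn : ∀ W H D F → gridSum W (suc H) D F ≡
    ∑ W (λ a → ind (D a 0) (F a 0)) ∙ gridSum W H (λ a b → D a (suc b)) (λ a b → F a (suc b))
  gridSum-firstColumn W H D F = ∑-∙ W _ _

  gridSum-lastRow-∅ : ∀ W H D F → (∀ b → b < H → D W b ≡ false) → gridSum (suc W) H D F ≡ gridSum W H D F
  gridSum-lastRow-∅ W H D F D≡false = begin
    gridSum (suc W) H D F
      ≡⟨ ∑-last W _ ⟩
    gridSum W H D F ∙ ∑ H (λ b → ind (D W b) (F W b))
      ≡⟨ cong (gridSum W H D F ∙_) (∑-ε H (λ b b<H → cong (λ z → ind z (F W b)) (D≡false b b<H))) ⟩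
    gridSum W H D F ∙ ε
      ≡⟨ identityʳ _ ⟩
    gridSum W H D F ∎

  gridSum-lexPrefix-fullRow : ∀ W H m F → gridSum (suc W) H (lexPrefix H (H + m)) F ≡
    ∑ H (F 0) ∙ gridSum W H (lexPrefix H m) (λ a b → F (suc a) b)
  gridSum-lexPrefix-fullRow W H m F = cong₂ _∙_
    (∑-ind-true H _ (F 0) (λ b b<H → <ᵇ-true (ℕₚ.<-≤-trans b<H (ℕₚ.m≤m+n H m))))
    (∑-cong W (λ a _ → ∑-cong H (λ b _ → cong (λ z → ind z (F (suc a) b)) (lexPrefix-nextRow H m a b))))

  gridSum-lexPrefix-firstRow : ∀ W H m F → m ≤ H → gridSum (suc W) H (lexPrefix H m) F ≡ ∑ m (F 0)
  gridSum-lexPrefix-firstRow W H m F m≤H = begin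
    ∑ H (λ b → ind (b <ᵇ m) (F 0 b)) ∙ gridSum W H (λ a → lexPrefix H m (suc a)) (F ∘ suc)
      ≡⟨ cong₂ _∙_ (∑-ind-< H m (F 0) m≤H) (gridSum-∅ W H _ _ (λ a b _ _ → <ᵇ-false (later a b))) ⟩
    ∑ m (F 0) ∙ ε
      ≡⟨ identityʳ _ ⟩
    ∑ m (F 0) ∎
    where
    later : ∀ a b → m ≤ suc a * H + b
    later a b = ℕₚ.≤-trans m≤H (ℕₚ.≤-trans (ℕₚ.m≤m+n H (a * H)) (ℕₚ.m≤m+n (H + a * H) b))

  gridSum-lexPrefix-lastRow : ∀ W H m F → m ≤ W * H →
                              gridSum (suc W) H (lexPrefix H m) F ≡ gridSum W H (lexPrefix H m) F
  gridSum-lexPrefix-lastRow W H m F m≤WH =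
    gridSum-lastRow-∅ W H _ F (λ b _ → <ᵇ-false (ℕₚ.≤-trans m≤WH (ℕₚ.m≤m+n (W * H) b)))

-- Sym on a square

square : ℕ → ℕ → ℕ → Packed
square s₁ s₂ d = packed s₁ (s₁ + d) s₂ (s₂ + d)

-- coord c i j is the local coordinate u_c of (s₁ + i , s₂ + j), and moves c₁ c₂ i j says whether
-- f_(c₁,c₂) = ρ f at that point.
coord : Fin 2 → ℕ → ℕ → ℕ
coord Fin.zero    i j = i
coord (Fin.suc _) i j = j

moves : Fin 2 → Fin 2 → ℕ → ℕ → Bool
moves c₁ c₂ i j = coord c₁ i j <ᵇ coord c₂ i j

moves-diagonal : ∀ c₁ c₂ i → moves c₁ c₂ i i ≡ false
moves-diagonal Fin.zero    Fin.zero    i = <ᵇ-false {i} ℕₚ.≤-refl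
moves-diagonal Fin.zero    (Fin.suc _) i = <ᵇ-false {i} ℕₚ.≤-refl
moves-diagonal (Fin.suc _) Fin.zero    i = <ᵇ-false {i} ℕₚ.≤-refl
moves-diagonal (Fin.suc _) (Fin.suc _) i = <ᵇ-false {i} ℕₚ.≤-refl

moves-offDiagonal : ∀ {c₁ c₂ i j} → c₁ ≢ c₂ → j < i →
  (moves c₁ c₂ i j ≡ true × moves c₁ c₂ j i ≡ false) ⊎ (moves c₁ c₂ i j ≡ false × moves c₁ c₂ j i ≡ true)
moves-offDiagonal {Fin.zero}          {Fin.zero}          c₁≢c₂ _   = contradiction refl c₁≢c₂
moves-offDiagonal {Fin.zero}          {Fin.suc Fin.zero}  _     j<i = inj₂ (<ᵇ-false (ℕₚ.<⇒≤ j<i) , <ᵇ-true j<i)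
moves-offDiagonal {Fin.suc Fin.zero}  {Fin.zero}          _     j<i = inj₁ (<ᵇ-true j<i , <ᵇ-false (ℕₚ.<⇒≤ j<i))
moves-offDiagonal {Fin.suc Fin.zero}  {Fin.suc Fin.zero}  c₁≢c₂ _   = contradiction refl c₁≢c₂

module SquareCoordinates (s₁ s₂ d : ℕ) where

  Q : Packed
  Q = square s₁ s₂ d

  at : ℕ → ℕ → Pt
  at i j = (s₁ + i , s₂ + j)

  at-injective : ∀ {i j i′ j′} → at i j ≡ at i′ j′ → i ≡ i′ × j ≡ j′
  at-injective eq = ℕₚ.+-cancelˡ-≡ s₁ _ _ (cong proj₁ eq) , ℕₚ.+-cancelˡ-≡ s₂ _ _ (cong proj₂ eq)

  inQ-at : ∀ {i j} → i ≤ d → j ≤ d → inQ Q (at i j) ≡ true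
  inQ-at {i} {j} i≤d j≤d =
    cong₂ _∧_ (≤ᵇ-true (ℕₚ.m≤m+n s₁ i)) (cong₂ _∧_ (≤ᵇ-true (ℕₚ.+-monoʳ-≤ s₁ i≤d))
    (cong₂ _∧_ (≤ᵇ-true (ℕₚ.m≤m+n s₂ j)) (≤ᵇ-true (ℕₚ.+-monoʳ-≤ s₂ j≤d))))

  inQ-bounds : ∀ a b → inQ Q (a , b) ≡ true → s₁ ≤ a × a ≤ s₁ + d × s₂ ≤ b × b ≤ s₂ + d
  inQ-bounds a b a,b∈Q =
    ≤ᵇ-sound (Boolₚ.∧-conicalˡ _ _ a,b∈Q) , ≤ᵇ-sound (Boolₚ.∧-conicalˡ _ _ a≤t₁∧b∈) ,
    ≤ᵇ-sound (Boolₚ.∧-conicalˡ _ _ b∈) , ≤ᵇ-sound (Boolₚ.∧-conicalʳ (s₂ ≤ᵇ b) _ b∈)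
    where
    a≤t₁∧b∈ : (a ≤ᵇ s₁ + d) ∧ (s₂ ≤ᵇ b) ∧ (b ≤ᵇ s₂ + d) ≡ true
    a≤t₁∧b∈ = Boolₚ.∧-conicalʳ (s₁ ≤ᵇ a) _ a,b∈Q
    b∈ : (s₂ ≤ᵇ b) ∧ (b ≤ᵇ s₂ + d) ≡ true
    b∈ = Boolₚ.∧-conicalʳ (a ≤ᵇ s₁ + d) _ a≤t₁∧b∈

  inQ⇒at : ∀ x → inQ Q x ≡ true → Σ ℕ λ i → Σ ℕ λ j → i ≤ d × j ≤ d × x ≡ at i j
  inQ⇒at (a , b) a,b∈Q with s₁≤a , a≤ , s₂≤b , b≤ ← inQ-bounds a b a,b∈Q
    with i , refl ← ℕₚ.m≤n⇒∃[o]m+o≡n s₁≤a | j , refl ← ℕₚ.m≤n⇒∃[o]m+o≡n s₂≤b =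
    i , j , ℕₚ.+-cancelˡ-≤ s₁ i d a≤ , ℕₚ.+-cancelˡ-≤ s₂ j d b≤ , refl

  ρ-at : ∀ i j → ρ Q (at i j) ≡ at j i
  ρ-at i j = cong₂ (λ p q → (s₁ + p , s₂ + q)) (ℕₚ.m+n∸m≡n s₂ j) (ℕₚ.m+n∸m≡n s₁ i)

  u-at : ∀ i j c → u Q (at i j) c ≡ coord c i j
  u-at i j Fin.zero    = ℕₚ.m+n∸m≡n s₁ i
  u-at i j (Fin.suc _) = ℕₚ.m+n∸m≡n s₂ j

  fc-at : ∀ c₁ c₂ i j → fc Q c₁ c₂ (at i j) ≡ (if moves c₁ c₂ i j then at j i else at i j)
  fc-at c₁ c₂ i j = cong₂ (λ p y → if p then y else at i j) (cong₂ _<ᵇ_ (u-at i j c₁) (u-at i j c₂)) (ρ-at i j)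

shrinks : ∀ p q {m m′} → m ≡ true → m′ ≡ false → (p ∧ q) ∨ ((p ∧ not m) ∨ (q ∧ m′)) ≡ p ∧ q
shrinks true  true  refl refl = refl
shrinks true  false refl refl = refl
shrinks false true  refl refl = refl
shrinks false false refl refl = refl

grows : ∀ p q {m m′} → m ≡ false → m′ ≡ true → (p ∧ q) ∨ ((p ∧ not m) ∨ (q ∧ m′)) ≡ p ∨ q
grows true  true  refl refl = refl
grows true  false refl refl = refl
grows false true  refl refl = refl
grows false false refl refl = refl

module SymmetrisedSquare (ℓ s₁ s₂ d : ℕ) (s₁+d<ℓ : s₁ + d < ℓ) (s₂+d<ℓ : s₂ + d < ℓ)
                         (c₁ c₂ : Fin 2) (c₁≢c₂ : c₁ ≢ c₂) (A : SubM) where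

  open SquareCoordinates s₁ s₂ d public

  image : Pt → Bool
  image x = any (λ f → A f ∧ inQ Q f ∧ eqPt (fc Q c₁ c₂ f) x) (cells ℓ)

  X : SubM
  X = Sym ℓ Q A c₁ c₂

  X-unfold : ∀ x → X x ≡ (A x ∧ not (inQ Q x)) ∨ (A x ∧ inQ Q x ∧ A (ρ Q x)) ∨ image x
  X-unfold x with c₁ Fin.≟ c₂
  ... | yes c₁≡c₂ = contradiction c₁≡c₂ c₁≢c₂
  ... | no  _     = refl

  image⇒ : ∀ x → image x ≡ true → Σ ℕ λ i → Σ ℕ λ j → i ≤ d × j ≤ d × A (at i j) ≡ true ×
           x ≡ (if moves c₁ c₂ i j then at j i else at i j)
  image⇒ x x∈image with f , hf ← any-true⇒ _ (cells ℓ) x∈image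
    with i , j , i≤d , j≤d , refl ← inQ⇒at f (Boolₚ.∧-conicalˡ _ _ (Boolₚ.∧-conicalʳ (A f) _ hf)) =
    i , j , i≤d , j≤d , Boolₚ.∧-conicalˡ _ _ hf ,
    trans (sym (eqPt⇒≡ _ x fc≡x)) (fc-at c₁ c₂ i j)
    where
    fc≡x = Boolₚ.∧-conicalʳ (inQ Q (at i j)) _ (Boolₚ.∧-conicalʳ (A (at i j)) _ hf)

  ⇒image : ∀ {i j} → i ≤ d → j ≤ d → A (at i j) ≡ true → image (fc Q c₁ c₂ (at i j)) ≡ true
  ⇒image {i} {j} i≤d j≤d Aij = ∈⇒any-true _ (∈-cells (ℕₚ.≤-<-trans (ℕₚ.+-monoʳ-≤ s₁ i≤d) s₁+d<ℓ)
                                                     (ℕₚ.≤-<-trans (ℕₚ.+-monoʳ-≤ s₂ j≤d) s₂+d<ℓ))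
                                      (cong₂ _∧_ Aij (cong₂ _∧_ (inQ-at i≤d j≤d) (eqPt-refl (fc Q c₁ c₂ (at i j)))))

  image-at : ∀ {i j} → i ≤ d → j ≤ d →
             image (at i j) ≡ (A (at i j) ∧ not (moves c₁ c₂ i j)) ∨ (A (at j i) ∧ moves c₁ c₂ j i)
  image-at {i} {j} i≤d j≤d = ≡true-ext to from
    where
    to : image (at i j) ≡ true → (A (at i j) ∧ not (moves c₁ c₂ i j)) ∨ (A (at j i) ∧ moves c₁ c₂ j i) ≡ true
    to y∈image with i′ , j′ , _ , _ , Ai′j′ , y≡ ← image⇒ (at i j) y∈image | moves c₁ c₂ i′ j′ in mv
    ... | true  with refl , refl ← at-injective y≡ = ∨-trueʳ _ (cong₂ _∧_ Ai′j′ mv)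
    ... | false with refl , refl ← at-injective y≡ =
      cong₂ (λ p q → (p ∧ not q) ∨ (A (at j i) ∧ moves c₁ c₂ j i)) Ai′j′ mv
    from : (A (at i j) ∧ not (moves c₁ c₂ i j)) ∨ (A (at j i) ∧ moves c₁ c₂ j i) ≡ true → image (at i j) ≡ true
    from h with ∨-true {A (at i j) ∧ not (moves c₁ c₂ i j)} h
    ... | inj₁ stays = subst (λ y → image y ≡ true) fc≡
                             (⇒image i≤d j≤d (Boolₚ.∧-conicalˡ _ _ stays))
      where
      fc≡ : fc Q c₁ c₂ (at i j) ≡ at i j
      fc≡ = trans (fc-at c₁ c₂ i j) (cong (λ p → if p then at j i else at i j)
                                          (Boolₚ.not-injective (Boolₚ.∧-conicalʳ _ _ stays)))
    ... | inj₂ arrives = subst (λ y → image y ≡ true) fc≡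
                               (⇒image j≤d i≤d (Boolₚ.∧-conicalˡ _ _ arrives))
      where
      fc≡ : fc Q c₁ c₂ (at j i) ≡ at i j
      fc≡ = trans (fc-at c₁ c₂ j i) (cong (λ p → if p then at i j else at j i) (Boolₚ.∧-conicalʳ _ _ arrives))

  image-outside : ∀ x → inQ Q x ≡ false → image x ≡ false
  image-outside x x∉Q = ≡true-ext to λ ()
    where
    to : image x ≡ true → false ≡ true
    to x∈image with i , j , i≤d , j≤d , _ , refl ← image⇒ x x∈image = trans (sym x∉Q) (inQ-target (moves c₁ c₂ i j))
      where
      inQ-target : ∀ p → inQ Q (if p then at j i else at i j) ≡ true
      inQ-target true  = inQ-at j≤d i≤d
      inQ-target false = inQ-at i≤d j≤d

  X-outside : ∀ x → inQ Q x ≡ false → X x ≡ A x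
  X-outside x x∉Q rewrite X-unfold x | x∉Q | image-outside x x∉Q = simplify (A x) (A (ρ Q x))
    where
    simplify : ∀ p q → (p ∧ true) ∨ (p ∧ false ∧ q) ∨ false ≡ p
    simplify true  q = refl
    simplify false q = refl

  X-at : ∀ {i j} → i ≤ d → j ≤ d →
         X (at i j) ≡ (A (at i j) ∧ A (at j i)) ∨
                      ((A (at i j) ∧ not (moves c₁ c₂ i j)) ∨ (A (at j i) ∧ moves c₁ c₂ j i))
  X-at {i} {j} i≤d j≤d rewrite X-unfold (at i j) | inQ-at i≤d j≤d | ρ-at i j | image-at i≤d j≤d =
    drop (A (at i j)) _
    where
    drop : ∀ p r → (p ∧ false) ∨ r ≡ r
    drop true  r = refl
    drop false r = refl

  X-diagonal : ∀ {i} → i ≤ d → X (at i i) ≡ A (at i i)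
  X-diagonal {i} i≤d = trans (X-at i≤d i≤d) (collapse (A (at i i)) (moves-diagonal c₁ c₂ i))
    where
    collapse : ∀ p {m} → m ≡ false → (p ∧ p) ∨ ((p ∧ not m) ∨ (p ∧ m)) ≡ p
    collapse true  refl = refl
    collapse false refl = refl

  X-offDiagonal : ∀ {i j} → j < i → i ≤ d →
    (X (at i j) ≡ A (at i j) ∧ A (at j i) × X (at j i) ≡ A (at j i) ∨ A (at i j)) ⊎
    (X (at i j) ≡ A (at i j) ∨ A (at j i) × X (at j i) ≡ A (at j i) ∧ A (at i j))
  X-offDiagonal {i} {j} j<i i≤d with moves-offDiagonal {c₁} {c₂} {i} {j} c₁≢c₂ j<i
  ... | inj₁ (ij-moves , ji-stays) =
    inj₁ (trans (X-at i≤d j≤d) (shrinks (A (at i j)) (A (at j i)) ij-moves ji-stays) ,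
          trans (X-at j≤d i≤d) (grows (A (at j i)) (A (at i j)) ji-stays ij-moves))
    where j≤d = ℕₚ.≤-trans (ℕₚ.<⇒≤ j<i) i≤d
  ... | inj₂ (ij-stays , ji-moves) =
    inj₂ (trans (X-at i≤d j≤d) (grows (A (at i j)) (A (at j i)) ij-stays ji-moves) ,
          trans (X-at j≤d i≤d) (shrinks (A (at j i)) (A (at i j)) ji-moves ij-stays))
    where j≤d = ℕₚ.≤-trans (ℕₚ.<⇒≤ j<i) i≤d

-- Sym preserves sums of rank-invariant functions

module Symmetrisation {R : Set} {_∙_ : Op₂ R} {ε : R} (isCM : IsCommutativeMonoid _≡_ _∙_ ε) where

  open IsCommutativeMonoid isCM using (comm)
  open FiniteSum isCM
  open ≡-Reasoning

  module Square (ℓ s₁ s₂ d : ℕ) (s₁+d<ℓ : s₁ + d < ℓ) (s₂+d<ℓ : s₂ + d < ℓ) where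

    open SquareCoordinates s₁ s₂ d

    cellSum-inQ : ∀ (F : Pt → R) → cellSum ℓ (λ x → ind (inQ Q x) (F x)) ≡ squareSum (suc d) (λ i j → F (at i j))
    cellSum-inQ F = begin
      ∑ ℓ (λ a → ∑ ℓ (λ b → ind (inQ Q (a , b)) (F (a , b))))
        ≡⟨ ∑-cong ℓ (λ a _ → ∑-cong ℓ (λ b _ → split-inQ a b)) ⟩
      ∑ ℓ (λ a → ∑ ℓ (λ b → ind (row a) (ind (column b) (F (a , b)))))
        ≡⟨ ∑-cong ℓ (λ a _ → sym (ind-∑ (row a) ℓ (λ b → ind (column b) (F (a , b))))) ⟩
      ∑ ℓ (λ a → ind (row a) (∑ ℓ (λ b → ind (column b) (F (a , b)))))
        ≡⟨ ∑-interval s₁ d ℓ (λ a → ∑ ℓ (λ b → ind (column b) (F (a , b)))) s₁+d<ℓ ⟩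
      ∑ (suc d) (λ i → ∑ ℓ (λ b → ind (column b) (F (s₁ + i , b))))
        ≡⟨ ∑-cong (suc d) (λ i _ → ∑-interval s₂ d ℓ (λ b → F (s₁ + i , b)) s₂+d<ℓ) ⟩
      squareSum (suc d) (λ i j → F (at i j)) ∎
      where
      row column : ℕ → Bool
      row a = (s₁ ≤ᵇ a) ∧ (a ≤ᵇ s₁ + d)
      column b = (s₂ ≤ᵇ b) ∧ (b ≤ᵇ s₂ + d)
      split-inQ : ∀ a b → ind (inQ Q (a , b)) (F (a , b)) ≡ ind (row a) (ind (column b) (F (a , b)))
      split-inQ a b = trans (cong (λ p → ind p (F (a , b))) (sym (Boolₚ.∧-assoc (s₁ ≤ᵇ a) _ _)))
                            (ind-∧ (row a) (column b) (F (a , b)))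

    cellSum-split-inQ : ∀ (F : Pt → R) → cellSum ℓ F ≡
      cellSum ℓ (λ x → ind (inQ Q x) (F x)) ∙ cellSum ℓ (λ x → ind (not (inQ Q x)) (F x))
    cellSum-split-inQ F = trans (∑-cong ℓ (λ a _ → trans (∑-cong ℓ (λ b _ → ind-split (inQ Q (a , b)) (F (a , b))))
                                                         (∑-∙ ℓ _ _)))
                                (∑-∙ ℓ _ _)

    cellSum-square-invariant : ∀ (F G : Pt → R) →
      (∀ a b → a < ℓ → b < ℓ → inQ Q (a , b) ≡ false → F (a , b) ≡ G (a , b)) →
      (∀ i → i ≤ d → F (at i i) ≡ G (at i i)) →
      (∀ i j → j < i → i ≤ d → F (at i j) ∙ F (at j i) ≡ G (at i j) ∙ G (at j i)) →
      cellSum ℓ F ≡ cellSum ℓ G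
    cellSum-square-invariant F G outside diag pair = begin
      cellSum ℓ F
        ≡⟨ cellSum-split-inQ F ⟩
      cellSum ℓ (λ x → ind (inQ Q x) (F x)) ∙ cellSum ℓ (λ x → ind (not (inQ Q x)) (F x))
        ≡⟨ cong₂ _∙_ inside (∑-cong ℓ (λ a a<ℓ → ∑-cong ℓ (λ b b<ℓ → outside′ a b a<ℓ b<ℓ))) ⟩
      cellSum ℓ (λ x → ind (inQ Q x) (G x)) ∙ cellSum ℓ (λ x → ind (not (inQ Q x)) (G x))
        ≡⟨ sym (cellSum-split-inQ G) ⟩
      cellSum ℓ G ∎
      where
      inside : cellSum ℓ (λ x → ind (inQ Q x) (F x)) ≡ cellSum ℓ (λ x → ind (inQ Q x) (G x))
      inside = begin
        cellSum ℓ (λ x → ind (inQ Q x) (F x))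
          ≡⟨ cellSum-inQ F ⟩
        squareSum (suc d) (λ i j → F (at i j))
          ≡⟨ squareSum-pairwise (suc d) (λ i j → F (at i j)) (λ i j → G (at i j)) (λ i i≤d → diag i (ℕₚ.≤-pred i≤d))
                                            (λ i j j<i i≤d → pair i j j<i (ℕₚ.≤-pred i≤d)) ⟩
        squareSum (suc d) (λ i j → G (at i j))
          ≡⟨ sym (cellSum-inQ G) ⟩
        cellSum ℓ (λ x → ind (inQ Q x) (G x)) ∎
      outside′ : ∀ a b → a < ℓ → b < ℓ → ind (not (inQ Q (a , b))) (F (a , b)) ≡ ind (not (inQ Q (a , b))) (G (a , b))
      outside′ a b a<ℓ b<ℓ with inQ Q (a , b) in a,b∉Q
      ... | true  = refl
      ... | false = outside a b a<ℓ b<ℓ a,b∉Q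

  cellSum-Sym : ∀ ℓ s₁ s₂ d → s₁ + d < ℓ → s₂ + d < ℓ → ∀ c₁ c₂ → c₁ ≢ c₂ →
    ∀ (A : SubM) (g : Pt → R) →
    (∀ i j → i ≤ d → j ≤ d → g (s₁ + j , s₂ + i) ≡ g (s₁ + i , s₂ + j)) →
    cellSum ℓ (λ x → ind (Sym ℓ (square s₁ s₂ d) A c₁ c₂ x) (g x)) ≡ cellSum ℓ (λ x → ind (A x) (g x))
  cellSum-Sym ℓ s₁ s₂ d s₁+d<ℓ s₂+d<ℓ c₁ c₂ c₁≢c₂ A g g-symmetric =
    cellSum-square-invariant (λ x → ind (X x) (g x)) (λ x → ind (A x) (g x))
      (λ a b _ _ a,b∉Q → cong (λ p → ind p (g (a , b))) (X-outside (a , b) a,b∉Q))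
      (λ i i≤d → cong (λ p → ind p (g (at i i))) (X-diagonal i≤d))
      pair
    where
    open Square ℓ s₁ s₂ d s₁+d<ℓ s₂+d<ℓ
    open SymmetrisedSquare ℓ s₁ s₂ d s₁+d<ℓ s₂+d<ℓ c₁ c₂ c₁≢c₂ A
      using (X; at; X-outside; X-diagonal; X-offDiagonal)
    pair : ∀ i j → j < i → i ≤ d →
           ind (X (at i j)) (g (at i j)) ∙ ind (X (at j i)) (g (at j i)) ≡
           ind (A (at i j)) (g (at i j)) ∙ ind (A (at j i)) (g (at j i))
    pair i j j<i i≤d rewrite g-symmetric i j i≤d (ℕₚ.≤-trans (ℕₚ.<⇒≤ j<i) i≤d) with X-offDiagonal j<i i≤d
    ... | inj₁ (Xij , Xji) rewrite Xij | Xji | Boolₚ.∨-comm (A (at j i)) (A (at i j)) =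
      ind-∧-∙-ind-∨ (A (at i j)) (A (at j i)) (g (at i j))
    ... | inj₂ (Xij , Xji) rewrite Xij | Xji | Boolₚ.∨-comm (A (at i j)) (A (at j i)) =
      trans (comm _ _) (trans (ind-∧-∙-ind-∨ (A (at j i)) (A (at i j)) (g (at i j))) (comm _ _))

  Sym-trivial : ∀ ℓ Q A c x → Sym ℓ Q A c c x ≡ A x
  Sym-trivial ℓ Q A c x with c Fin.≟ c
  ... | yes _   = refl
  ... | no  c≢c = contradiction refl c≢c

  cellSum-TypeSet : ∀ ℓ init m X (g : Pt → R) → TypeSet ℓ init m X →
    (∀ a b c d → a < ℓ → b < ℓ → c < ℓ → d < ℓ → rank (a , b) ≡ rank (c , d) → g (a , b) ≡ g (c , d)) →
    cellSum ℓ (λ x → ind (X x) (g x)) ≡ cellSum ℓ (λ x → ind (init ℓ m x) (g x))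
  cellSum-TypeSet ℓ init m X g (Q , c₁ , c₂ , Q⊆M , defined , X≗Sym , _) g-rank =
    trans (gridSum-cong ℓ ℓ (λ a b → g (a , b)) (λ a b a<ℓ b<ℓ → X≗Sym (a , b) (inM-true a<ℓ b<ℓ)))
          (Sym-sum Q Q⊆M defined)
    where
    Sym-sum : ∀ Q → PackedIn ℓ Q → SymDefined Q c₁ c₂ →
      cellSum ℓ (λ x → ind (Sym ℓ Q (init ℓ m) c₁ c₂ x) (g x)) ≡ cellSum ℓ (λ x → ind (init ℓ m x) (g x))
    Sym-sum Q _ (inj₁ refl) = gridSum-cong ℓ ℓ (λ a b → g (a , b)) (λ a b _ _ → Sym-trivial ℓ Q (init ℓ m) c₁ (a , b))
    Sym-sum (packed s₁ t₁ s₂ t₂) (s₁≤t₁ , t₁<ℓ , s₂≤t₂ , t₂<ℓ) (inj₂ (c₁≢c₂ , sides≡))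
      with d , refl ← ℕₚ.m≤n⇒∃[o]m+o≡n s₁≤t₁ | d₂ , refl ← ℕₚ.m≤n⇒∃[o]m+o≡n s₂≤t₂
      with refl ← trans (sym (ℕₚ.m+n∸m≡n s₁ d)) (trans sides≡ (ℕₚ.m+n∸m≡n s₂ d₂)) =
      cellSum-Sym ℓ s₁ s₂ d t₁<ℓ t₂<ℓ c₁ c₂ c₁≢c₂ (init ℓ m) g symmetric
      where
      symmetric : ∀ i j → i ≤ d → j ≤ d → g (s₁ + j , s₂ + i) ≡ g (s₁ + i , s₂ + j)
      symmetric i j i≤d j≤d = g-rank _ _ _ _ (inside s₁ j≤d t₁<ℓ) (inside s₂ i≤d t₂<ℓ)
                                             (inside s₁ i≤d t₁<ℓ) (inside s₂ j≤d t₂<ℓ) (swap-rank s₁ s₂ i j)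
        where
        inside : ∀ s {k} → k ≤ d → s + d < ℓ → s + k < ℓ
        inside s k≤d s+d<ℓ = ℕₚ.≤-<-trans (ℕₚ.+-monoʳ-≤ s k≤d) s+d<ℓ
        swap-rank : ∀ s₁ s₂ i j → (s₁ + j) + (s₂ + i) ≡ (s₁ + i) + (s₂ + j)
        swap-rank = solve-∀

-- Rank weights of downsets of a rectangle

module ℚΣ = FiniteSum ℚₚ.+-0-isCommutativeMonoid
module ℕΣ = FiniteSum ℕₚ.+-0-isCommutativeMonoid
module ℚSym = Symmetrisation ℚₚ.+-0-isCommutativeMonoid
module ℕSym = Symmetrisation ℕₚ.+-0-isCommutativeMonoid

∑-const : ∀ n c → ℕΣ.∑ n (λ _ → c) ≡ n * c
∑-const zero    c = refl
∑-const (suc n) c = cong (c +_) (∑-const n c)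

∑-1 : ∀ n → ℕΣ.∑ n (λ _ → 1) ≡ n
∑-1 n = trans (∑-const n 1) (ℕₚ.*-identityʳ n)

open ℚΣ using (∑; ∑-cong; ∑-+; ind; gridSum)

IsGridDownset : ℕ → ℕ → Grid → Set
IsGridDownset W H D = ∀ a b c d → c < W → d < H → a ≤ c → b ≤ d → D c d ≡ true → D a b ≡ true

gridSize : ℕ → ℕ → Grid → ℕ
gridSize W H D = ℕΣ.gridSum W H D (λ _ _ → 1)

rankWeight : (ℕ → ℚ) → ℕ → ℕ → Grid → ℚ
rankWeight w W H D = gridSum W H D (λ a b → w (a + b))

NonDecreasing : (ℕ → ℚ) → Set
NonDecreasing w = ∀ r → w r ≤ℚ w (suc r)

nonDecreasing-≤ : ∀ {w} → NonDecreasing w → ∀ {r s} → r ≤ s → w r ≤ℚ w s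
nonDecreasing-≤ {w} mono {r} r≤s with k , refl ← ℕₚ.m≤n⇒∃[o]m+o≡n r≤s = go k
  where
  go : ∀ k → w r ≤ℚ w (r + k)
  go zero    = ℚₚ.≤-reflexive (cong w (sym (ℕₚ.+-identityʳ r)))
  go (suc k) = ℚₚ.≤-trans (go k) (subst (λ s → w (r + k) ≤ℚ w s) (sym (ℕₚ.+-suc r k)) (mono (r + k)))

nonDecreasing-suc : ∀ {w} → NonDecreasing w → NonDecreasing (w ∘ suc)
nonDecreasing-suc mono r = mono (suc r)

∑-mono-≤ : ∀ n {f g : ℕ → ℚ} → (∀ i → i < n → f i ≤ℚ g i) → ∑ n f ≤ℚ ∑ n g
∑-mono-≤ zero    f≤g = ℚₚ.≤-refl
∑-mono-≤ (suc n) f≤g = ℚₚ.+-mono-≤ (f≤g 0 (s≤s z≤n)) (∑-mono-≤ n (λ i i<n → f≤g (suc i) (s≤s i<n)))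

rankWeight-fullRow : ∀ w W H m → rankWeight w (suc W) H (lexPrefix H (H + m)) ≡
                     ∑ H w +ℚ rankWeight (w ∘ suc) W H (lexPrefix H m)
rankWeight-fullRow w W H m = ℚΣ.gridSum-lexPrefix-fullRow W H m (λ a b → w (a + b))

rankWeight-firstRow : ∀ w W H m → m ≤ H → rankWeight w (suc W) H (lexPrefix H m) ≡ ∑ m w
rankWeight-firstRow w W H m = ℚΣ.gridSum-lexPrefix-firstRow W H m (λ a b → w (a + b))

shortRow-fits : ∀ W′ k n w → NonDecreasing w → n ≤ k →
  ∑ (suc W′) w +ℚ ∑ n (w ∘ suc) ≤ℚ rankWeight w (suc W′) (suc (W′ + k)) (lexPrefix (suc (W′ + k)) (n + suc W′))
shortRow-fits W′ k n w mono n≤k = begin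
  ∑ (suc W′) w +ℚ ∑ n (w ∘ suc)
    ≤⟨ ℚₚ.+-monoʳ-≤ (∑ (suc W′) w) (∑-mono-≤ n (λ i _ → nonDecreasing-≤ mono (s≤s (ℕₚ.m≤n+m i W′)))) ⟩
  ∑ (suc W′) w +ℚ ∑ n (λ i → w (suc W′ + i))
    ≡⟨ sym (∑-+ (suc W′) n w) ⟩
  ∑ (suc W′ + n) w
    ≡⟨ cong (λ z → ∑ z w) (ℕₚ.+-comm (suc W′) n) ⟩
  ∑ (n + suc W′) w
    ≡⟨ sym (rankWeight-firstRow w W′ _ (n + suc W′) fits) ⟩
  rankWeight w (suc W′) (suc (W′ + k)) (lexPrefix (suc (W′ + k)) (n + suc W′)) ∎
  where
  open ℚₚ.≤-Reasoning
  fits : n + suc W′ ≤ suc (W′ + k)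
  fits = ℕₚ.≤-trans (ℕₚ.≤-reflexive (ℕₚ.+-comm n (suc W′))) (s≤s (ℕₚ.+-monoʳ-≤ W′ n≤k))

shortRow-overflows : ∀ W′ k e w → NonDecreasing w → e < W′ →
  ∑ (suc W′) w +ℚ ∑ (k + e) (w ∘ suc) ≤ℚ
  rankWeight w (suc W′) (suc (W′ + k)) (lexPrefix (suc (W′ + k)) (suc (W′ + k) + e))
shortRow-overflows (suc W″) k e w mono e<W′ = begin
  ∑ W w +ℚ ∑ (k + e) (w ∘ suc)
    ≡⟨ cong (λ z → ∑ W w +ℚ ∑ z (w ∘ suc)) (ℕₚ.+-comm k e) ⟩
  ∑ W w +ℚ ∑ (e + k) (w ∘ suc)
    ≡⟨ cong (∑ W w +ℚ_) (∑-+ e k (w ∘ suc)) ⟩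
  ∑ W w +ℚ (∑ e (w ∘ suc) +ℚ ∑ k (λ i → w (suc (e + i))))
    ≤⟨ ℚₚ.+-monoʳ-≤ (∑ W w) (ℚₚ.+-monoʳ-≤ (∑ e (w ∘ suc))
         (∑-mono-≤ k (λ i _ → nonDecreasing-≤ mono (s≤s (ℕₚ.+-monoˡ-≤ i e≤W′))))) ⟩
  ∑ W w +ℚ (∑ e (w ∘ suc) +ℚ ∑ k (λ i → w (W + i)))
    ≡⟨ cong (∑ W w +ℚ_) (ℚₚ.+-comm (∑ e (w ∘ suc)) _) ⟩
  ∑ W w +ℚ (∑ k (λ i → w (W + i)) +ℚ ∑ e (w ∘ suc))
    ≡⟨ sym (ℚₚ.+-assoc (∑ W w) _ _) ⟩
  (∑ W w +ℚ ∑ k (λ i → w (W + i))) +ℚ ∑ e (w ∘ suc)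
    ≡⟨ cong₂ _+ℚ_ (sym (∑-+ W k w)) (sym (rankWeight-firstRow (w ∘ suc) W″ (suc H) e e≤H)) ⟩
  ∑ (suc H) w +ℚ rankWeight (w ∘ suc) (suc W″) (suc H) (lexPrefix (suc H) e)
    ≡⟨ sym (rankWeight-fullRow w (suc W″) (suc H) e) ⟩
  rankWeight w W (suc H) (lexPrefix (suc H) (suc H + e)) ∎
  where
  open ℚₚ.≤-Reasoning
  W = suc (suc W″)
  H = suc W″ + k
  e≤W′ : e ≤ suc W″
  e≤W′ = ℕₚ.<⇒≤ e<W′
  e≤H : e ≤ suc H
  e≤H = ℕₚ.≤-trans e≤W′ (ℕₚ.≤-trans (ℕₚ.m≤m+n (suc W″) k) (ℕₚ.n≤1+n H))

firstColumn+shortRow≤lexPrefix : ∀ W′ H n w → NonDecreasing w → W′ ≤ H → n < H →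
  ∑ (suc W′) w +ℚ ∑ n (w ∘ suc) ≤ℚ rankWeight w (suc W′) (suc H) (lexPrefix (suc H) (n + suc W′))
firstColumn+shortRow≤lexPrefix W′ H n w mono W′≤H n<H with k , refl ← ℕₚ.m≤n⇒∃[o]m+o≡n W′≤H | n ≤? k
... | yes n≤k = shortRow-fits W′ k n w mono n≤k
... | no  n≰k with e , refl ← ℕₚ.m≤n⇒∃[o]m+o≡n (ℕₚ.<⇒≤ (ℕₚ.≰⇒> n≰k)) =
  subst (λ z → ∑ (suc W′) w +ℚ ∑ (k + e) (w ∘ suc) ≤ℚ
               rankWeight w (suc W′) (suc (W′ + k)) (lexPrefix (suc (W′ + k)) z))
        (rearrange k e W′)
        (shortRow-overflows W′ k e w mono e<W′)
  where
  e<W′ : e < W′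
  e<W′ = ℕₚ.+-cancelˡ-< k e W′ (ℕₚ.<-≤-trans n<H (ℕₚ.≤-reflexive (ℕₚ.+-comm W′ k)))
  rearrange : ∀ k e W′ → suc (W′ + k) + e ≡ (k + e) + suc W′
  rearrange = solve-∀

-- The left side is the weight of the first column together with the row-major prefix of size n
-- shifted one column to the right.
firstColumn+lexPrefix≤lexPrefix : ∀ W H n w → NonDecreasing w → W ≤ suc H → n ≤ W * H →
  ∑ W w +ℚ rankWeight (w ∘ suc) W H (lexPrefix H n) ≤ℚ rankWeight w W (suc H) (lexPrefix (suc H) (n + W))
firstColumn+lexPrefix≤lexPrefix zero H n w mono _ _ = ℚₚ.≤-refl
firstColumn+lexPrefix≤lexPrefix (suc W′) H n w mono (s≤s W′≤H) n≤WH with H ≤? n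
... | no  H≰n = begin
  ∑ (suc W′) w +ℚ rankWeight (w ∘ suc) (suc W′) H (lexPrefix H n)
    ≡⟨ cong (∑ (suc W′) w +ℚ_) (rankWeight-firstRow (w ∘ suc) W′ H n (ℕₚ.<⇒≤ n<H)) ⟩
  ∑ (suc W′) w +ℚ ∑ n (w ∘ suc)
    ≤⟨ firstColumn+shortRow≤lexPrefix W′ H n w mono W′≤H n<H ⟩
  rankWeight w (suc W′) (suc H) (lexPrefix (suc H) (n + suc W′)) ∎
  where
  open ℚₚ.≤-Reasoning
  n<H = ℕₚ.≰⇒> H≰n
... | yes H≤n with n′ , refl ← ℕₚ.m≤n⇒∃[o]m+o≡n H≤n = begin
  (w 0 +ℚ ∑ W′ (w ∘ suc)) +ℚ rankWeight (w ∘ suc) (suc W′) H (lexPrefix H (H + n′))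
    ≡⟨ cong ((w 0 +ℚ ∑ W′ (w ∘ suc)) +ℚ_) (rankWeight-fullRow (w ∘ suc) W′ H n′) ⟩
  (w 0 +ℚ ∑ W′ (w ∘ suc)) +ℚ (∑ H (w ∘ suc) +ℚ rankWeight (w ∘ suc ∘ suc) W′ H (lexPrefix H n′))
    ≡⟨ +-interchange (w 0) (∑ W′ (w ∘ suc)) (∑ H (w ∘ suc)) _ ⟩
  (w 0 +ℚ ∑ H (w ∘ suc)) +ℚ (∑ W′ (w ∘ suc) +ℚ rankWeight (w ∘ suc ∘ suc) W′ H (lexPrefix H n′))
    ≤⟨ ℚₚ.+-monoʳ-≤ (∑ (suc H) w)
         (firstColumn+lexPrefix≤lexPrefix W′ H n′ (w ∘ suc) (nonDecreasing-suc mono)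
           (ℕₚ.m≤n⇒m≤1+n W′≤H) (ℕₚ.+-cancelˡ-≤ H n′ (W′ * H) n≤WH)) ⟩
  ∑ (suc H) w +ℚ rankWeight (w ∘ suc) W′ (suc H) (lexPrefix (suc H) (n′ + W′))
    ≡⟨ sym (rankWeight-fullRow w W′ (suc H) (n′ + W′)) ⟩
  rankWeight w (suc W′) (suc H) (lexPrefix (suc H) (suc H + (n′ + W′)))
    ≡⟨ cong (λ z → rankWeight w (suc W′) (suc H) (lexPrefix (suc H) z)) (rearrange H n′ W′) ⟩
  rankWeight w (suc W′) (suc H) (lexPrefix (suc H) ((H + n′) + suc W′)) ∎
  where
  open ℚₚ.≤-Reasoning
  rearrange : ∀ H n′ W′ → suc H + (n′ + W′) ≡ (H + n′) + suc W′
  rearrange = solve-∀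

gridSize-≤ : ∀ W H D → gridSize W H D ≤ W * H
gridSize-≤ zero    H D = z≤n
gridSize-≤ (suc W) H D = ℕₚ.+-mono-≤ (row-≤ H (D 0)) (gridSize-≤ W H (D ∘ suc))
  where
  ind-≤ : ∀ b → ℕΣ.ind b 1 ≤ 1
  ind-≤ true  = ℕₚ.≤-refl
  ind-≤ false = z≤n
  row-≤ : ∀ H (p : ℕ → Bool) → ℕΣ.∑ H (λ b → ℕΣ.ind (p b) 1) ≤ H
  row-≤ zero    p = z≤n
  row-≤ (suc H) p = ℕₚ.+-mono-≤ (ind-≤ (p 0)) (row-≤ H (p ∘ suc))

gridSize-fullFirstRow : ∀ W H D → (∀ b → b < H → D 0 b ≡ true) → gridSize (suc W) H D ≡ H + gridSize W H (D ∘ suc)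
gridSize-fullFirstRow W H D full = cong (_+ gridSize W H (D ∘ suc)) (trans (ℕΣ.∑-ind-true H (D 0) _ full) (∑-1 H))

gridSize-fullFirstColumn : ∀ W H D → (∀ a → a < W → D a 0 ≡ true) →
                           gridSize W (suc H) D ≡ W + gridSize W H (λ a b → D a (suc b))
gridSize-fullFirstColumn W H D full =
  trans (ℕΣ.gridSum-firstColumn W H D (λ _ _ → 1))
        (cong (_+ gridSize W H (λ a b → D a (suc b))) (trans (ℕΣ.∑-ind-true W (λ a → D a 0) _ full) (∑-1 W)))

rankWeight-firstColumn : ∀ w W H D → rankWeight w W (suc H) D ≡
  ∑ W (λ a → ind (D a 0) (w a)) +ℚ rankWeight (w ∘ suc) W H (λ a b → D a (suc b))
rankWeight-firstColumn w W H D = begin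
  rankWeight w W (suc H) D
    ≡⟨ ℚΣ.gridSum-firstColumn W H D (λ a b → w (a + b)) ⟩
  ∑ W (λ a → ind (D a 0) (w (a + 0))) +ℚ gridSum W H D↑ (λ a b → w (a + suc b))
    ≡⟨ cong₂ _+ℚ_ (∑-cong W (λ a _ → cong (λ r → ind (D a 0) (w r)) (ℕₚ.+-identityʳ a)))
                  (ℚΣ.∑-cong W (λ a _ → ℚΣ.∑-cong H (λ b _ → cong (λ r → ind (D a (suc b)) (w r)) (ℕₚ.+-suc a b)))) ⟩
  ∑ W (λ a → ind (D a 0) (w a)) +ℚ rankWeight (w ∘ suc) W H D↑ ∎
  where
  open ≡-Reasoning
  D↑ = λ a b → D a (suc b)

rankWeight-transpose : ∀ w W H D → rankWeight w W H D ≡ rankWeight w H W (λ b a → D a b)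
rankWeight-transpose w W H D = trans (ℚΣ.gridSum-transpose W H D (λ a b → w (a + b)))
  (ℚΣ.∑-cong H (λ b _ → ℚΣ.∑-cong W (λ a _ → cong (λ r → ind (D a b) (w r)) (ℕₚ.+-comm a b))))

downset-dropFirstRow : ∀ W H D → IsGridDownset (suc W) H D → IsGridDownset W H (D ∘ suc)
downset-dropFirstRow W H D down a b c d c<W d<H a≤c b≤d = down (suc a) b (suc c) d (s≤s c<W) d<H (s≤s a≤c) b≤d

downset-dropFirstColumn : ∀ W H D → IsGridDownset W (suc H) D → IsGridDownset W H (λ a b → D a (suc b))
downset-dropFirstColumn W H D down a b c d c<W d<H a≤c b≤d = down a (suc b) c (suc d) c<W (s≤s d<H) a≤c (s≤s b≤d)

downset-dropLastRow : ∀ W H D → IsGridDownset (suc W) H D → IsGridDownset W H D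
downset-dropLastRow W H D down a b c d c<W = down a b c d (ℕₚ.m≤n⇒m≤1+n c<W)

downset-transpose : ∀ W H D → IsGridDownset W H D → IsGridDownset H W (λ b a → D a b)
downset-transpose W H D down a b c d c<H d<W a≤c b≤d = down b a d c d<W c<H b≤d a≤c

LexPrefixMaximal : ℕ → Set
LexPrefixMaximal m = ∀ W H w → NonDecreasing w → W ≤ H → ∀ D → IsGridDownset W H D → gridSize W H D ≡ m →
                     rankWeight w W H D ≤ℚ rankWeight w W H (lexPrefix H m)

fullFirstRow-step : ∀ m → (∀ {m′} → m′ < m → LexPrefixMaximal m′) →
  ∀ W′ H′ w → NonDecreasing w → W′ ≤ H′ → ∀ D → IsGridDownset (suc W′) (suc H′) D →
  gridSize (suc W′) (suc H′) D ≡ m → D 0 H′ ≡ true →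
  rankWeight w (suc W′) (suc H′) D ≤ℚ rankWeight w (suc W′) (suc H′) (lexPrefix (suc H′) m)
fullFirstRow-step m ih W′ H′ w mono W′≤H′ D down size≡m D0H′ = begin
  ∑ H (λ b → ind (D 0 b) (w b)) +ℚ rankWeight (w ∘ suc) W′ H (D ∘ suc)
    ≡⟨ cong (_+ℚ rankWeight (w ∘ suc) W′ H (D ∘ suc)) (ℚΣ.∑-ind-true H (D 0) w full) ⟩
  ∑ H w +ℚ rankWeight (w ∘ suc) W′ H (D ∘ suc)
    ≤⟨ ℚₚ.+-monoʳ-≤ (∑ H w) (ih m′<m W′ H (w ∘ suc) (nonDecreasing-suc mono) (ℕₚ.m≤n⇒m≤1+n W′≤H′)
                                (D ∘ suc) (downset-dropFirstRow W′ H D down) refl) ⟩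
  ∑ H w +ℚ rankWeight (w ∘ suc) W′ H (lexPrefix H m′)
    ≡⟨ sym (rankWeight-fullRow w W′ H m′) ⟩
  rankWeight w (suc W′) H (lexPrefix H (H + m′))
    ≡⟨ cong (λ z → rankWeight w (suc W′) H (lexPrefix H z)) (sym m≡H+m′) ⟩
  rankWeight w (suc W′) H (lexPrefix H m) ∎
  where
  open ℚₚ.≤-Reasoning
  H = suc H′
  m′ = gridSize W′ H (D ∘ suc)
  full : ∀ b → b < H → D 0 b ≡ true
  full b b<H = down 0 b 0 H′ (s≤s z≤n) ℕₚ.≤-refl z≤n (ℕₚ.≤-pred b<H) D0H′
  m≡H+m′ : m ≡ H + m′
  m≡H+m′ = trans (sym size≡m) (gridSize-fullFirstRow W′ H D full)
  m′<m : m′ < m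
  m′<m = subst (m′ <_) (sym m≡H+m′) (s≤s (ℕₚ.m≤n+m m′ H′))

fullFirstColumn-step : ∀ m → (∀ {m′} → m′ < m → LexPrefixMaximal m′) →
  ∀ W′ H′ w → NonDecreasing w → W′ < H′ → ∀ D → IsGridDownset (suc W′) (suc H′) D →
  gridSize (suc W′) (suc H′) D ≡ m → D W′ 0 ≡ true →
  rankWeight w (suc W′) (suc H′) D ≤ℚ rankWeight w (suc W′) (suc H′) (lexPrefix (suc H′) m)
fullFirstColumn-step m ih W′ H′ w mono W≤H′ D down size≡m DW′0 = begin
  rankWeight w W (suc H′) D
    ≡⟨ rankWeight-firstColumn w W H′ D ⟩
  ∑ W (λ a → ind (D a 0) (w a)) +ℚ rankWeight (w ∘ suc) W H′ D↑
    ≡⟨ cong (_+ℚ rankWeight (w ∘ suc) W H′ D↑) (ℚΣ.∑-ind-true W (λ a → D a 0) w full) ⟩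
  ∑ W w +ℚ rankWeight (w ∘ suc) W H′ D↑
    ≤⟨ ℚₚ.+-monoʳ-≤ (∑ W w) (ih n<m W H′ (w ∘ suc) (nonDecreasing-suc mono) W≤H′
                                D↑ (downset-dropFirstColumn W H′ D down) refl) ⟩
  ∑ W w +ℚ rankWeight (w ∘ suc) W H′ (lexPrefix H′ n)
    ≤⟨ firstColumn+lexPrefix≤lexPrefix W H′ n w mono (ℕₚ.m≤n⇒m≤1+n W≤H′) (gridSize-≤ W H′ D↑) ⟩
  rankWeight w W (suc H′) (lexPrefix (suc H′) (n + W))
    ≡⟨ cong (λ z → rankWeight w W (suc H′) (lexPrefix (suc H′) z)) (trans (ℕₚ.+-comm n W) (sym m≡W+n)) ⟩
  rankWeight w W (suc H′) (lexPrefix (suc H′) m) ∎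
  where
  open ℚₚ.≤-Reasoning
  W = suc W′
  D↑ = λ a b → D a (suc b)
  n = gridSize W H′ D↑
  full : ∀ a → a < W → D a 0 ≡ true
  full a a<W = down a 0 W′ 0 ℕₚ.≤-refl (s≤s z≤n) (ℕₚ.≤-pred a<W) z≤n DW′0
  m≡W+n : m ≡ W + n
  m≡W+n = trans (sym size≡m) (gridSize-fullFirstColumn W H′ D full)
  n<m : n < m
  n<m = subst (n <_) (sym m≡W+n) (s≤s (ℕₚ.m≤n+m n W′))

lexPrefixMaximal-step : ∀ m → (∀ {m′} → m′ < m → LexPrefixMaximal m′) → LexPrefixMaximal m
lexPrefixMaximal-step m ih zero H w mono _ D _ _ = ℚₚ.≤-refl
lexPrefixMaximal-step m ih (suc W′) (suc H′) w mono (s≤s W′≤H′) D down size≡m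
  with D 0 H′ in D0H′ | D W′ 0 in DW′0
... | true  | _    = fullFirstRow-step m ih W′ H′ w mono W′≤H′ D down size≡m D0H′
... | false | true with ℕₚ.m≤n⇒m<n∨m≡n W′≤H′
...   | inj₁ W′<H′ = fullFirstColumn-step m ih W′ H′ w mono W′<H′ D down size≡m DW′0
...   | inj₂ refl  = begin
  rankWeight w W W D
    ≡⟨ rankWeight-transpose w W W D ⟩
  rankWeight w W W Dᵀ
    ≤⟨ fullFirstRow-step m ih W′ W′ w mono ℕₚ.≤-refl Dᵀ (downset-transpose W W D down)
                         (trans (sym (ℕΣ.gridSum-transpose W W D (λ _ _ → 1))) size≡m) DW′0 ⟩
  rankWeight w W W (lexPrefix W m) ∎
  where
  open ℚₚ.≤-Reasoning
  W = suc W′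
  Dᵀ = λ b a → D a b
lexPrefixMaximal-step m ih (suc W′) (suc H′) w mono (s≤s W′≤H′) D down size≡m
    | false | false = begin
  rankWeight w (suc W′) H D
    ≡⟨ ℚΣ.gridSum-lastRow-∅ W′ H D (λ a b → w (a + b)) lastRowEmpty ⟩
  rankWeight w W′ H D
    ≤⟨ lexPrefixMaximal-step m ih W′ H w mono (ℕₚ.m≤n⇒m≤1+n W′≤H′)
                             D (downset-dropLastRow W′ H D down) size′≡m ⟩
  rankWeight w W′ H (lexPrefix H m)
    ≡⟨ sym (ℚΣ.gridSum-lexPrefix-lastRow W′ H m (λ a b → w (a + b))
                                           (subst (_≤ W′ * H) size′≡m (gridSize-≤ W′ H D))) ⟩
  rankWeight w (suc W′) H (lexPrefix H m) ∎
  where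
  open ℚₚ.≤-Reasoning
  H = suc H′
  lastRowEmpty : ∀ b → b < H → D W′ b ≡ false
  lastRowEmpty b b<H with D W′ b in DW′b
  ... | false = refl
  ... | true  = contradiction (trans (sym (down W′ 0 W′ b ℕₚ.≤-refl b<H ℕₚ.≤-refl z≤n DW′b)) DW′0) λ ()
  size′≡m : gridSize W′ H D ≡ m
  size′≡m = trans (sym (ℕΣ.gridSum-lastRow-∅ W′ H D (λ _ _ → 1) lastRowEmpty)) size≡m

lexPrefix-maximal : ∀ m → LexPrefixMaximal m
lexPrefix-maximal = <-rec LexPrefixMaximal lexPrefixMaximal-step

-- Initial segments of 𝓛 and 𝓒

gridSize-lexPrefix : ∀ W H m → m ≤ W * H → gridSize W H (lexPrefix H m) ≡ m
gridSize-lexPrefix zero    H zero _ = refl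
gridSize-lexPrefix (suc W) H m m≤WH with m ≤? H
... | yes m≤H = trans (ℕΣ.gridSum-lexPrefix-firstRow W H m (λ _ _ → 1) m≤H) (∑-1 m)
... | no  m≰H with m′ , refl ← ℕₚ.m≤n⇒∃[o]m+o≡n (ℕₚ.<⇒≤ (ℕₚ.≰⇒> m≰H)) =
  trans (ℕΣ.gridSum-lexPrefix-fullRow W H m′ (λ _ _ → 1))
        (cong₂ _+_ (∑-1 H) (gridSize-lexPrefix W H m′ (ℕₚ.+-cancelˡ-≤ H m′ (W * H) m≤WH)))

length≡∑1 : ∀ {B : Set} (xs : List B) → length xs ≡ ℕΣ.fold (map (λ _ → 1) xs)
length≡∑1 []       = refl
length≡∑1 (x ∷ xs) = cong suc (length≡∑1 xs)

size≡gridSize : ∀ ℓ S → size ℓ S ≡ gridSize ℓ ℓ (λ a b → S (a , b))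
size≡gridSize ℓ S = trans (length≡∑1 (filterᵇ S (cells ℓ)))
  (trans (ℕΣ.fold-map-filterᵇ S (λ _ → 1) (cells ℓ)) (ℕΣ.fold-map-cells ℓ _))

wtSet≡gridSum : ∀ ℓ wt S → wtSet ℓ wt S ≡ gridSum ℓ ℓ (λ a b → S (a , b)) (λ a b → wt (a , b))
wtSet≡gridSum ℓ wt S = trans (ℚΣ.fold-map-filterᵇ S wt (cells ℓ)) (ℚΣ.fold-map-cells ℓ _)

+-suc-≡ᵇ : ∀ m n → (m + suc n ≡ᵇ m) ≡ false
+-suc-≡ᵇ zero    n = refl
+-suc-≡ᵇ (suc m) n = +-suc-≡ᵇ m n

lexPredecessors : ∀ ℓ a b → a < ℓ → b ≤ ℓ →
  gridSize ℓ ℓ (λ c d → (c <ᵇ a) ∨ ((c ≡ᵇ a) ∧ (d <ᵇ b))) ≡ a * ℓ + b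
lexPredecessors ℓ a b a<ℓ b≤ℓ with k , refl ← ℕₚ.m≤n⇒∃[o]m+o≡n a<ℓ = begin
  ℕΣ.∑ (suc a + k) row
    ≡⟨ cong (λ n → ℕΣ.∑ n row) (sym (ℕₚ.+-suc a k)) ⟩
  ℕΣ.∑ (a + suc k) row
    ≡⟨ ℕΣ.∑-+ a (suc k) row ⟩
  ℕΣ.∑ a row + (row (a + 0) + ℕΣ.∑ k (λ i → row (a + suc i)))
    ≡⟨ cong₂ _+_ rowsBefore (cong₂ _+_ rowOf-a (ℕΣ.∑-ε k (λ i _ → rowAfter i))) ⟩
  a * ℓ + (b + 0)
    ≡⟨ cong (a * ℓ +_) (ℕₚ.+-identityʳ b) ⟩
  a * ℓ + b ∎
  where
  open ≡-Reasoning
  row : ℕ → ℕ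
  row c = ℕΣ.∑ ℓ (λ d → ℕΣ.ind ((c <ᵇ a) ∨ ((c ≡ᵇ a) ∧ (d <ᵇ b))) 1)
  rowsBefore : ℕΣ.∑ a row ≡ a * ℓ
  rowsBefore = trans (ℕΣ.∑-cong a (λ c c<a → trans (cong (λ p → rowWith p c) (<ᵇ-true c<a)) (∑-1 ℓ))) (∑-const a ℓ)
    where
    rowWith : Bool → ℕ → ℕ
    rowWith p c = ℕΣ.∑ ℓ (λ d → ℕΣ.ind (p ∨ ((c ≡ᵇ a) ∧ (d <ᵇ b))) 1)
  rowOf-a : row (a + 0) ≡ b
  rowOf-a = begin
    row (a + 0)
      ≡⟨ cong row (ℕₚ.+-identityʳ a) ⟩
    ℕΣ.∑ ℓ (λ d → ℕΣ.ind ((a <ᵇ a) ∨ ((a ≡ᵇ a) ∧ (d <ᵇ b))) 1)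
      ≡⟨ ℕΣ.∑-cong ℓ (λ d _ → cong₂ (λ p q → ℕΣ.ind (p ∨ (q ∧ (d <ᵇ b))) 1)
                                     (<ᵇ-false {a} ℕₚ.≤-refl) (≡ᵇ-refl a)) ⟩
    ℕΣ.∑ ℓ (λ d → ℕΣ.ind (d <ᵇ b) 1)
      ≡⟨ ℕΣ.∑-ind-< ℓ b (λ _ → 1) b≤ℓ ⟩
    ℕΣ.∑ b (λ _ → 1)
      ≡⟨ ∑-1 b ⟩
    b ∎
  rowAfter : ∀ i → row (a + suc i) ≡ 0
  rowAfter i = ℕΣ.∑-ε ℓ (λ d _ → cong₂ (λ p q → ℕΣ.ind (p ∨ (q ∧ (d <ᵇ b))) 1)
                                        (<ᵇ-false (ℕₚ.m≤m+n a (suc i))) (+-suc-≡ᵇ a i))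

initL≡lexPrefix : ∀ ℓ m a b → a < ℓ → b < ℓ → initL ℓ m (a , b) ≡ lexPrefix ℓ m a b
initL≡lexPrefix ℓ m a b a<ℓ b<ℓ = cong₂ (λ p n → p ∧ (n <ᵇ m)) (inM-true a<ℓ b<ℓ)
  (trans (size≡gridSize ℓ (λ y → ltL y (a , b))) (lexPredecessors ℓ a b a<ℓ (ℕₚ.<⇒≤ b<ℓ)))

initC≡lexPrefix : ∀ ℓ m a b → a < ℓ → b < ℓ → initC ℓ m (a , b) ≡ lexPrefix ℓ m b a
initC≡lexPrefix ℓ m a b a<ℓ b<ℓ = cong₂ (λ p n → p ∧ (n <ᵇ m)) (inM-true a<ℓ b<ℓ)
  (trans (size≡gridSize ℓ (λ y → ltC y (a , b)))
  (trans (ℕΣ.gridSum-transpose ℓ ℓ _ (λ _ _ → 1)) (lexPredecessors ℓ b a b<ℓ (ℕₚ.<⇒≤ a<ℓ))))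

-- Rank constant and rank increasing weights

cellOfRank : ℕ → ℕ → Pt
cellOfRank k r = (r ⊓ k , (r ∸ k) ⊓ k)

rank-cellOfRank : ∀ k r → rank (cellOfRank k r) ≡ r ⊓ (k + k)
rank-cellOfRank k r with r ≤? k
... | yes r≤k = begin
  r ⊓ k + (r ∸ k) ⊓ k  ≡⟨ cong₂ (λ p q → p + q ⊓ k) (ℕₚ.m≤n⇒m⊓n≡m r≤k) (ℕₚ.m≤n⇒m∸n≡0 r≤k) ⟩
  r + 0               ≡⟨ ℕₚ.+-identityʳ r ⟩
  r                   ≡⟨ sym (ℕₚ.m≤n⇒m⊓n≡m (ℕₚ.≤-trans r≤k (ℕₚ.m≤m+n k k))) ⟩
  r ⊓ (k + k)         ∎
  where open ≡-Reasoning
... | no  r≰k with s , refl ← ℕₚ.m≤n⇒∃[o]m+o≡n (ℕₚ.<⇒≤ (ℕₚ.≰⇒> r≰k)) = begin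
  (k + s) ⊓ k + (k + s ∸ k) ⊓ k
    ≡⟨ cong₂ (λ p q → p + q ⊓ k) (ℕₚ.m≥n⇒m⊓n≡n (ℕₚ.m≤m+n k s)) (ℕₚ.m+n∸m≡n k s) ⟩
  k + s ⊓ k
    ≡⟨ ℕₚ.+-distribˡ-⊓ k s k ⟩
  (k + s) ⊓ (k + k) ∎
  where open ≡-Reasoning

module RankWeight (k : ℕ) (wt : Pt → ℚ)
                  (increasing : RankIncreasing (suc k) wt) (constant : RankConstant (suc k) wt) where

  ℓ : ℕ
  ℓ = suc k

  w : ℕ → ℚ
  w r = wt (cellOfRank k r)

  cellOfRank₁< : ∀ r → r ⊓ k < ℓ
  cellOfRank₁< r = s≤s (ℕₚ.m⊓n≤n r k)

  cellOfRank₂< : ∀ r → (r ∸ k) ⊓ k < ℓ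
  cellOfRank₂< r = s≤s (ℕₚ.m⊓n≤n (r ∸ k) k)

  wt≡w : ∀ a b → a < ℓ → b < ℓ → wt (a , b) ≡ w (a + b)
  wt≡w a b (s≤s a≤k) (s≤s b≤k) = constant _ _ _ _ (s≤s a≤k) (s≤s b≤k) (cellOfRank₁< (a + b)) (cellOfRank₂< (a + b))
    (sym (trans (rank-cellOfRank k (a + b)) (ℕₚ.m≤n⇒m⊓n≡m (ℕₚ.+-mono-≤ a≤k b≤k))))

  w-nonDecreasing : NonDecreasing w
  w-nonDecreasing r with ℕₚ.m≤n⇒m<n∨m≡n (ℕₚ.⊓-monoˡ-≤ (k + k) (ℕₚ.n≤1+n r))
  ... | inj₁ lt = ℚₚ.<⇒≤ (increasing _ _ _ _ (cellOfRank₁< r) (cellOfRank₂< r)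
                                             (cellOfRank₁< (suc r)) (cellOfRank₂< (suc r))
                           (subst₂ _<_ (sym (rank-cellOfRank k r)) (sym (rank-cellOfRank k (suc r))) lt))
  ... | inj₂ eq = ℚₚ.≤-reflexive (constant _ _ _ _ (cellOfRank₁< r) (cellOfRank₂< r)
                                                     (cellOfRank₁< (suc r)) (cellOfRank₂< (suc r))
                           (trans (rank-cellOfRank k r) (trans eq (sym (rank-cellOfRank k (suc r))))))

  wtSet≡rankWeight : ∀ S → wtSet ℓ wt S ≡ rankWeight w ℓ ℓ (λ a b → S (a , b))
  wtSet≡rankWeight S = trans (wtSet≡gridSum ℓ wt S)
    (ℚΣ.∑-cong ℓ (λ a a<ℓ → ℚΣ.∑-cong ℓ (λ b b<ℓ → cong (ind (S (a , b))) (wt≡w a b a<ℓ b<ℓ))))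

  wtSet-initL : ∀ m → wtSet ℓ wt (initL ℓ m) ≡ rankWeight w ℓ ℓ (lexPrefix ℓ m)
  wtSet-initL m = trans (wtSet≡rankWeight (initL ℓ m)) (ℚΣ.gridSum-cong ℓ ℓ (λ a b → w (a + b)) (initL≡lexPrefix ℓ m))

  wtSet-initC : ∀ m → wtSet ℓ wt (initC ℓ m) ≡ rankWeight w ℓ ℓ (lexPrefix ℓ m)
  wtSet-initC m = trans (wtSet≡rankWeight (initC ℓ m))
    (trans (ℚΣ.gridSum-cong ℓ ℓ (λ a b → w (a + b)) (initC≡lexPrefix ℓ m))
           (sym (rankWeight-transpose w ℓ ℓ (lexPrefix ℓ m))))

  size-initL : ∀ m → m ≤ ℓ * ℓ → size ℓ (initL ℓ m) ≡ m
  size-initL m m≤ℓℓ = trans (size≡gridSize ℓ (initL ℓ m))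
    (trans (ℕΣ.gridSum-cong ℓ ℓ (λ _ _ → 1) (initL≡lexPrefix ℓ m)) (gridSize-lexPrefix ℓ ℓ m m≤ℓℓ))

  size-initC : ∀ m → m ≤ ℓ * ℓ → size ℓ (initC ℓ m) ≡ m
  size-initC m m≤ℓℓ = trans (size≡gridSize ℓ (initC ℓ m))
    (trans (ℕΣ.gridSum-cong ℓ ℓ (λ _ _ → 1) (initC≡lexPrefix ℓ m))
    (trans (sym (ℕΣ.gridSum-transpose ℓ ℓ (lexPrefix ℓ m) (λ _ _ → 1))) (gridSize-lexPrefix ℓ ℓ m m≤ℓℓ)))

  typeSet-optimal : ∀ init → (∀ m → m ≤ ℓ * ℓ → size ℓ (init ℓ m) ≡ m) →
    (∀ m → wtSet ℓ wt (init ℓ m) ≡ rankWeight w ℓ ℓ (lexPrefix ℓ m)) →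
    ∀ m → m ≤ ℓ * ℓ → ∀ X → TypeSet ℓ init m X → IsOptimalDownset ℓ wt X
  typeSet-optimal init size-init wtSet-init m m≤ℓℓ X typeSet@(_ , _ , _ , _ , _ , _ , down) = down , optimal
    where
    X-size : size ℓ X ≡ m
    X-size = trans (size≡gridSize ℓ X) (trans (ℕSym.cellSum-TypeSet ℓ init m X (λ _ → 1) typeSet (λ _ _ _ _ _ _ _ _ _ → refl))
                   (trans (sym (size≡gridSize ℓ (init ℓ m))) (size-init m m≤ℓℓ)))
    X-weight : wtSet ℓ wt X ≡ rankWeight w ℓ ℓ (lexPrefix ℓ m)
    X-weight = trans (wtSet≡gridSum ℓ wt X) (trans (ℚSym.cellSum-TypeSet ℓ init m X wt typeSet constant)
                     (trans (sym (wtSet≡gridSum ℓ wt (init ℓ m))) (wtSet-init m)))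
    optimal : ∀ D → IsDownset ℓ D → size ℓ D ≡ size ℓ X → wtSet ℓ wt D ≤ℚ wtSet ℓ wt X
    optimal D D-down D-size = begin
      wtSet ℓ wt D
        ≡⟨ wtSet≡rankWeight D ⟩
      rankWeight w ℓ ℓ (λ a b → D (a , b))
        ≤⟨ lexPrefix-maximal m ℓ ℓ w w-nonDecreasing ℕₚ.≤-refl _ D-down
             (trans (sym (size≡gridSize ℓ D)) (trans D-size X-size)) ⟩
      rankWeight w ℓ ℓ (lexPrefix ℓ m)
        ≡⟨ sym X-weight ⟩
      wtSet ℓ wt X ∎
      where open ℚₚ.≤-Reasoning

corollary4p1 : (ℓ : ℕ) → 1 ≤ ℓ → (wt : Pt → ℚ) →
    RankIncreasing ℓ wt → RankConstant ℓ wt →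
    ((m : ℕ) → m ≤ ℓ * ℓ → wtSet ℓ wt (initC ℓ m) ≡ wtSet ℓ wt (initL ℓ m))
    × ((m : ℕ) → m ≤ ℓ * ℓ → (X : SubM) → TypeSet ℓ initL m X → IsOptimalDownset ℓ wt X)
    × ((m : ℕ) → m ≤ ℓ * ℓ → (X : SubM) → TypeSet ℓ initC m X → IsOptimalDownset ℓ wt X)
corollary4p1 (suc k) _ wt increasing constant =
  (λ m _ → trans (wtSet-initC m) (sym (wtSet-initL m))) ,
  typeSet-optimal initL size-initL wtSet-initL ,
  typeSet-optimal initC size-initC wtSet-initC
  where open RankWeight k wt increasing constant
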